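{- For every permutation $\sigma\in S_D$, any non-commutative algebraic branching program computing $\Delta_\sigma(P_d)$ has width $m^{\Omega(d)}$.
   Context: Let $T_d$ be the complete binary tree of depth $d$ (with $2^d$ leaves) and $D=2^{d+1}-1$ its number of nodes; let $v_1,\ldots,v_D$ be its nodes in in-order (left subtree recursively, root, right subtree recursively). A colouring $\gamma:T_d\to\mathbb{Z}_m$ (colours identified with $[m]$) is legal if for every internal node $u$ with children $v,w$, $\gamma(u)=\gamma(v)+\gamma(w)\bmod m$. Define $P_d(x_1,\ldots,x_m)=\sum_{\gamma\text{ legal}}x_{\gamma(v_1)}\cdots x_{\gamma(v_D)}$, a homogeneous degree-$D$ polynomial in non-commuting variables. For $\sigma\in S_D$, $\Delta_\sigma(P)$ is the image of $P$ under the linear map with $\Delta_\sigma(x_{w_1}\cdots x_{w_D})=x_{w_{\sigma(1)}}\cdots x_{w_{\sigma(D)}}$. A non-commutative algebraic branching program is a layered directed acyclic graph with a source and a sink, edges labelled by linear forms in $x_1,\ldots,x_m$, computing the sum over source-to-sink paths of the ordered product of edge labels; its width is the maximum number of vertices in a layer. -}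

module Defs where

open import Level using (Level; _⊔_)
open import Data.Nat as ℕ using (ℕ; zero; suc; NonZero; _≟_)
open import Data.Nat.DivMod using (_mod_)
open import Data.Fin as Fin using (Fin; toℕ; cast)
import Data.Fin.Properties as FinP
open import Data.Fin.Permutation using (Permutation′; _⟨$⟩ˡ_)
open import Data.List as List using (List; []; _∷_; _++_; length; reverse)
import Data.List.Properties as ListP
open import Data.Bool using (Bool; true; false; _∧_; if_then_else_)
open import Relation.Nullary using (¬_; yes; no)
open import Relation.Nullary.Decidable using (⌊_⌋)
open import Relation.Binary.PropositionalEquality using (_≡_; refl; sym; subst)
open import Data.Product using (Σ; ∃; _×_; _,_)
open import Algebra.Bundles using (CommutativeRing)

record Field (c ℓ : Level) : Set (Level.suc (c ⊔ ℓ)) where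
  field
    commutativeRing : CommutativeRing c ℓ
  open CommutativeRing commutativeRing public
  field
    1≉0      : ¬ (1# ≈ 0#)
    inverse  : ∀ x → ¬ (x ≈ 0#) → Σ Carrier λ y → x * y ≈ 1#

module _ {c ℓ : Level} (F : Field c ℓ) where
  open Field F using (Carrier; _≈_; _+_; _*_; 0#; 1#)

  sumFin : (n : ℕ) → (Fin n → Carrier) → Carrier
  sumFin zero    f = 0#
  sumFin (suc n) f = f Fin.zero + sumFin n (λ i → f (Fin.suc i))

  -- A non-commutative polynomial in x_1..x_m with coefficients in F,
  -- given by its coefficient function on words (monomials) over [m].
  NCPoly : ℕ → Set c
  NCPoly m = List (Fin m) → Carrier

  _≈ₚ_ : ∀ {m} → NCPoly m → NCPoly m → Set ℓ
  P ≈ₚ Q = ∀ w → P w ≈ Q w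

  -- Layers 0,1,…,len; layer i has `size i` vertices; the source is in
  -- layer 0 and the sink in layer len; the edge from vertex u of layer i
  -- to vertex v of layer i+1 is labelled by the linear form
  -- Σ_a (label i u v a) · x_a (a zero form = no edge).
  record ABP (m : ℕ) : Set c where
    field
      len    : ℕ
      size   : ℕ → ℕ
      source : Fin (size 0)
      sink   : Fin (size len)
      label  : (i : ℕ) → Fin (size i) → Fin (size (suc i)) → Fin m → Carrier

    -- fwd rw v : for a word w with reverse w = rw, the sum over all paths
    -- from the source to vertex v of layer |w| of the product of the
    -- coefficients of x_{w_1},…,x_{w_|w|} in the successive edge labels.
    fwd : (rw : List (Fin m)) → Fin (size (length rw)) → Carrier
    fwd []       v = if ⌊ v Fin.≟ source ⌋ then 1# else 0#
    fwd (a ∷ rw) v = sumFin (size (length rw)) λ u → fwd rw u * label (length rw) u v a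

    computed : NCPoly m
    computed w with length (reverse w) ≟ len
    ... | yes eq = fwd (reverse w) (subst (λ k → Fin (size k)) (sym eq) sink)
    ... | no _   = 0#

  open ABP public

  -- The width is the maximum number of vertices in a layer; "width ≥ N"
  -- is expressed as: some layer i ≤ len has at least N vertices.
  WidthAtLeast : ∀ {m} → ABP m → ℕ → Set
  WidthAtLeast A N = Σ ℕ λ i → i ℕ.≤ len A × N ℕ.≤ size A i

-- Colourings of the complete binary tree T_d by Z_m (colours = Fin m),
-- represented as T_d with each node labelled by its colour.

data CTree (m : ℕ) : ℕ → Set where
  leaf : Fin m → CTree m 0
  node : ∀ {d} → CTree m d → Fin m → CTree m d → CTree m (suc d)

root : ∀ {m d} → CTree m d → Fin m
root (leaf a)     = a
root (node _ a _) = a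

_+ₘ_ : ∀ {m} .{{_ : NonZero m}} → Fin m → Fin m → Fin m
_+ₘ_ {m} a b = (toℕ a ℕ.+ toℕ b) mod m

legal : ∀ {m d} .{{_ : NonZero m}} → CTree m d → Bool
legal (leaf _)     = true
legal (node l a r) = legal l ∧ ⌊ a Fin.≟ (root l +ₘ root r) ⌋ ∧ legal r

inorder : ∀ {m d} → CTree m d → List (Fin m)
inorder (leaf a)     = a ∷ []
inorder (node l a r) = inorder l ++ (a ∷ inorder r)

allFinL : (m : ℕ) → List (Fin m)
allFinL m = List.tabulate (λ i → i)

allCTrees : (m d : ℕ) → List (CTree m d)
allCTrees m zero    = List.map leaf (allFinL m)
allCTrees m (suc d) =
  List.concatMap (λ l → List.concatMap (λ a → List.map (λ r → node l a r)
    (allCTrees m d)) (allFinL m)) (allCTrees m d)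

nodes : ℕ → ℕ
nodes d = 2 ℕ.^ (suc d) ℕ.∸ 1

module _ {c ℓ : Level} (F : Field c ℓ) where
  open Field F using (Carrier; _≈_; _+_; _*_; 0#; 1#)

  Pd : (m : ℕ) .{{_ : NonZero m}} → (d : ℕ) → NCPoly F m
  Pd m d w = List.foldr (λ t acc →
      (if legal t ∧ ⌊ ListP.≡-dec Fin._≟_ (inorder t) w ⌋ then 1# else 0#) + acc)
    0# (allCTrees m d)

  -- Δ_σ for σ ∈ S_D, acting on homogeneous degree-D polynomials:
  -- Δ_σ(x_{w_1}⋯x_{w_D}) = x_{w_σ(1)}⋯x_{w_σ(D)}, extended linearly.
  -- Hence coeff of u in Δ_σ(P) = coeff of w in P where w_{σ(i)} = u_i,
  -- i.e. w_j = u_{σ⁻¹(j)}; words of length ≠ D get coefficient 0.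
  Δ : ∀ {m} (D : ℕ) → Permutation′ D → NCPoly F m → NCPoly F m
  Δ D σ P u with length u ≟ D
  ... | yes eq = P (List.tabulate (λ j → List.lookup u (cast (sym eq) (σ ⟨$⟩ˡ j))))
  ... | no _   = 0#

-- A program computing Q factors every coefficient through any layer:
-- Q(uv) = Σ_x f_u(x) g_v(x), summed over the vertices x of layer |u|.
-- So if prefixes u_a and suffixes v_b, for a and b ranging over N values,
-- satisfy Q(u_a v_b) = [a = b], that layer has at least N vertices, by the
-- rank bound for a factorisation A · B = I over a field.
--
-- For Q = Δ_σ(P_d) the coefficient of a word is 1 or 0 according as the
-- colouring of T_d it spells out after undoing σ is legal. Cutting the word
-- after i letters marks the nodes whose letters land in the prefix, and it
-- suffices to find m^k legal colourings γ_a such that taking the marked nodes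
-- from γ_a and the others from γ_b is legal only for a = b. An edge whose ends
-- are marked differently carries one free colour: put c below it, propagate c
-- upwards through zeros, and the sum rule at the upper end forces the colours
-- hidden in γ_a and γ_b to agree. Recursing into three disjoint subtrees of
-- depth d - 2 and cutting at the median of their cuts gains one such colour
-- every two levels, so k = ⌊d/2⌋ and m^d ≤ N^4.

module Submission where

open import Defs
open import Level using (Level)
open import Data.Nat using (ℕ; suc; NonZero; _≤_; _^_)
open import Data.Product using (Σ; _×_)
open import Data.Fin.Permutation using (Permutation′)

open import Data.Nat as ℕ using (zero; _<_; _∸_; z≤n; s≤s; ⌊_/2⌋)
import Data.Nat.Properties as ℕₚ
open import Data.Fin as Fin using (Fin; toℕ; punchIn)
import Data.Fin.Properties as Finₚ
open import Data.Bool using (Bool; true; false; if_then_else_; T; _∧_) renaming (_≟_ to _≟ᴮ_)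
open import Data.Bool.Properties using (T-∧; T-≡; if-float; if-eta; ∧-identityʳ)
open import Data.Unit using (⊤)
open import Relation.Nullary using (¬_; yes; no)
open import Relation.Nullary.Decidable using (⌊_⌋)
open import Relation.Binary.PropositionalEquality as ≡ using (_≡_; _≢_)
open import Data.Product using (_,_; proj₁; proj₂)
open import Data.Empty using (⊥; ⊥-elim)
open import Function using (_∘_)
open import Function.Bundles using (Equivalence)
open import Data.Sum using (_⊎_; inj₁; inj₂)
open import Data.List as List using (List; []; _∷_; _++_; length; reverse)
import Data.List.Properties as Listₚ
open import Data.Fin.Permutation using (_⟨$⟩ˡ_; _⟨$⟩ʳ_; inverseʳ)

¬¬-∀-Fin : ∀ {p} n (Q : Fin n → Set p) → (∀ x → ¬ ¬ Q x) → ¬ ¬ (∀ x → Q x)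
¬¬-∀-Fin zero    Q h k = k λ ()
¬¬-∀-Fin (suc n) Q h k =
  h Fin.zero λ q₀ → ¬¬-∀-Fin n (Q ∘ Fin.suc) (h ∘ Fin.suc) λ qₛ →
    k λ { Fin.zero → q₀ ; (Fin.suc x) → qₛ x }

⌊≟⌋≡≡ᵇ : ∀ {n} (x y : Fin n) → ⌊ x Fin.≟ y ⌋ ≡ (toℕ x ℕ.≡ᵇ toℕ y)
⌊≟⌋≡≡ᵇ Fin.zero    Fin.zero    = ≡.refl
⌊≟⌋≡≡ᵇ Fin.zero    (Fin.suc y) = ≡.refl
⌊≟⌋≡≡ᵇ (Fin.suc x) Fin.zero    = ≡.refl
⌊≟⌋≡≡ᵇ (Fin.suc x) (Fin.suc y) with x Fin.≟ y | ⌊≟⌋≡≡ᵇ x y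
... | yes _ | x≡ᵇy = x≡ᵇy
... | no _  | x≡ᵇy = x≡ᵇy

if-≢ : ∀ {A : Set} {β β′ : Bool} {x y : A} → β ≢ β′ → (if β then x else y) ≡ (if β′ then x else y) → x ≡ y
if-≢ {β = true}  {true}  β≢β′ _ = ⊥-elim (β≢β′ ≡.refl)
if-≢ {β = false} {false} β≢β′ _ = ⊥-elim (β≢β′ ≡.refl)
if-≢ {β = true}  {false} _    e = e
if-≢ {β = false} {true}  _    e = ≡.sym e

if-T : ∀ {a} {A : Set a} {β} {x y : A} → T β → (if β then x else y) ≡ x
if-T {β = true} _ = ≡.refl

lookupOr : ∀ {A : Set} → A → List A → ℕ → A
lookupOr a []       _       = a
lookupOr a (x ∷ xs) zero    = x
lookupOr a (x ∷ xs) (suc k) = lookupOr a xs k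

applyUpTo-lookupOr : ∀ {A : Set} (a : A) xs → List.applyUpTo (lookupOr a xs) (length xs) ≡ xs
applyUpTo-lookupOr a []       = ≡.refl
applyUpTo-lookupOr a (x ∷ xs) = ≡.cong (x ∷_) (applyUpTo-lookupOr a xs)

module _ {A : Set} where
  open ≡ using (refl; cong; cong₂)

  applyUpTo-cong : ∀ {f g : ℕ → A} n → (∀ k → f k ≡ g k) → List.applyUpTo f n ≡ List.applyUpTo g n
  applyUpTo-cong zero    f≗g = refl
  applyUpTo-cong (suc n) f≗g = cong₂ _∷_ (f≗g 0) (applyUpTo-cong n (f≗g ∘ suc))

  applyUpTo-+ : ∀ (f : ℕ → A) a b → List.applyUpTo f (a ℕ.+ b) ≡ List.applyUpTo f a ++ List.applyUpTo (λ k → f (a ℕ.+ k)) b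
  applyUpTo-+ f zero    b = refl
  applyUpTo-+ f (suc a) b = cong (f 0 ∷_) (applyUpTo-+ (f ∘ suc) a b)

  applyUpTo-<ᵇ : ∀ (f g : ℕ → A) {i n} → i ≤ n →
                 List.applyUpTo (λ k → if k ℕ.<ᵇ i then f k else g k) n ≡
                 List.applyUpTo f i ++ List.applyUpTo (λ k → g (i ℕ.+ k)) (n ∸ i)
  applyUpTo-<ᵇ f g {zero}              _         = refl
  applyUpTo-<ᵇ f g {suc i} {suc n} (s≤s i≤n) = cong (f 0 ∷_) (applyUpTo-<ᵇ (f ∘ suc) (g ∘ suc) i≤n)

  tabulate-toℕ : ∀ n (f : ℕ → A) → List.tabulate {n = n} (f ∘ toℕ) ≡ List.applyUpTo f n
  tabulate-toℕ zero    f = refl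
  tabulate-toℕ (suc n) f = cong (f 0 ∷_) (tabulate-toℕ n (f ∘ suc))

  select : List Bool → List A → List A → List A
  select (β ∷ βs) (x ∷ xs) (y ∷ ys) = (if β then x else y) ∷ select βs xs ys
  select _        _        _        = []

  select-++ : ∀ βs xs ys {βs′ xs′ ys′} → length βs ≡ length xs → length xs ≡ length ys →
              select (βs ++ βs′) (xs ++ xs′) (ys ++ ys′) ≡ select βs xs ys ++ select βs′ xs′ ys′
  select-++ []       []       []       _  _  = refl
  select-++ (β ∷ βs) (x ∷ xs) (y ∷ ys) e₁ e₂ =
    cong ((if β then x else y) ∷_) (select-++ βs xs ys (ℕₚ.suc-injective e₁) (ℕₚ.suc-injective e₂))

  select-applyUpTo : ∀ n (β : ℕ → Bool) (f g : ℕ → A) →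
    select (List.applyUpTo β n) (List.applyUpTo f n) (List.applyUpTo g n) ≡ List.applyUpTo (λ k → if β k then f k else g k) n
  select-applyUpTo zero    β f g = refl
  select-applyUpTo (suc n) β f g = cong (_ ∷_) (select-applyUpTo n (β ∘ suc) (f ∘ suc) (g ∘ suc))

-- Extended by the identity outside Fin n, so that inverse permutations stay
-- inverse on all of ℕ.
onℕ : ∀ {n} → (Fin n → Fin n) → ℕ → ℕ
onℕ {n} π k with k ℕ.<? n
... | yes k<n = toℕ (π (Fin.fromℕ< k<n))
... | no  _   = k

module _ {n : ℕ} where
  open ≡ using (refl; cong; trans)

  onℕ-toℕ : ∀ (π : Fin n → Fin n) x → onℕ π (toℕ x) ≡ toℕ (π x)
  onℕ-toℕ π x with toℕ x ℕ.<? n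
  ... | yes x<n = cong (toℕ ∘ π) (Finₚ.fromℕ<-toℕ x x<n)
  ... | no  x≮n = ⊥-elim (x≮n (Finₚ.toℕ<n x))

  onℕ-outside : ∀ (π : Fin n → Fin n) {k} → ¬ k < n → onℕ π k ≡ k
  onℕ-outside π {k} k≮n with k ℕ.<? n
  ... | yes k<n = ⊥-elim (k≮n k<n)
  ... | no  _   = refl

  onℕ-< : ∀ (π : Fin n → Fin n) {k} → k < n → onℕ π k < n
  onℕ-< π {k} k<n with k ℕ.<? n
  ... | yes _   = Finₚ.toℕ<n _
  ... | no  k≮n = ⊥-elim (k≮n k<n)

  onℕ-inverse : ∀ (π π′ : Fin n → Fin n) → (∀ x → π′ (π x) ≡ x) → ∀ k → onℕ π′ (onℕ π k) ≡ k
  onℕ-inverse π π′ inverse k with k ℕ.<? n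
  ... | yes k<n = trans (onℕ-toℕ π′ (π (Fin.fromℕ< k<n))) (trans (cong toℕ (inverse _)) (Finₚ.toℕ-fromℕ< k<n))
  ... | no  k≮n = onℕ-outside π′ k≮n

Δ-applyUpTo : ∀ {c ℓ} (F : Field c ℓ) {m} D (σ : Permutation′ D) (Q : NCPoly F m) (f : ℕ → Fin m) →
              Δ F D σ Q (List.applyUpTo f D) ≡ Q (List.applyUpTo (f ∘ onℕ (σ ⟨$⟩ˡ_)) D)
Δ-applyUpTo F D σ Q f with length (List.applyUpTo f D) ℕ.≟ D
... | no  ≢D = ⊥-elim (≢D (Listₚ.length-applyUpTo f D))
... | yes e  = ≡.cong Q (≡.trans (Listₚ.tabulate-cong letter) (tabulate-toℕ D (f ∘ onℕ (σ ⟨$⟩ˡ_))))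
  where
  letter : ∀ j → List.lookup (List.applyUpTo f D) (Fin.cast (≡.sym e) (σ ⟨$⟩ˡ j)) ≡ f (onℕ (σ ⟨$⟩ˡ_) (toℕ j))
  letter j = ≡.trans (Listₚ.lookup-applyUpTo f D _)
               (≡.cong f (≡.trans (Finₚ.toℕ-cast _ (σ ⟨$⟩ˡ j)) (≡.sym (onℕ-toℕ (σ ⟨$⟩ˡ_) j))))

module _ {m : ℕ} where
  open import Data.Vec using (Vec; []; _∷_)
  import Data.Vec.Properties as Vecₚ

  toVec : ∀ k → Fin (m ^ k) → Vec (Fin m) k
  toVec zero    _ = []
  toVec (suc k) x = proj₁ (Fin.remQuot {m} (m ^ k) x) ∷ toVec k (proj₂ (Fin.remQuot {m} (m ^ k) x))

  toVec-injective : ∀ k {x y : Fin (m ^ k)} → toVec k x ≡ toVec k y → x ≡ y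
  toVec-injective zero    {Fin.zero} {Fin.zero} _ = ≡.refl
  toVec-injective (suc k) {x} {y} e = begin
    x                                 ≡⟨ Finₚ.combine-remQuot {m} (m ^ k) x ⟨
    Fin.combine (proj₁ qx) (proj₂ qx) ≡⟨ ≡.cong₂ Fin.combine (Vecₚ.∷-injectiveˡ e) (toVec-injective k (Vecₚ.∷-injectiveʳ e)) ⟩
    Fin.combine (proj₁ qy) (proj₂ qy) ≡⟨ Finₚ.combine-remQuot {m} (m ^ k) y ⟩
    y                                 ∎
    where
    open ≡.≡-Reasoning
    qx = Fin.remQuot {m} (m ^ k) x
    qy = Fin.remQuot {m} (m ^ k) y

-- Rank of an identity factorisation

module Matrices {c ℓ : Level} (F : Field c ℓ) where
  open Field F
  open import Algebra.Properties.Semiring.Sum semiring public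
  open import Algebra.Properties.Ring ring using (-1*x≈-x; x[y-z]≈xy-xz; -0#≈0#)
  open import Relation.Binary.Reasoning.Setoid setoid

  sumFin≡∑ : ∀ n (f : Fin n → Carrier) → sumFin F n f ≡ ∑[ i < n ] f i
  sumFin≡∑ zero    f = ≡.refl
  sumFin≡∑ (suc n) f = ≡.cong (f Fin.zero +_) (sumFin≡∑ n (λ i → f (Fin.suc i)))

  ∑-zero : ∀ n (f : Fin n → Carrier) → (∀ i → f i ≈ 0#) → ∑[ i < n ] f i ≈ 0#
  ∑-zero n f f≈0 = trans (sum-cong-≋ f≈0) (sum-replicate-zero n)

  ∑-distrib-sub : ∀ {n} (f g : Fin n → Carrier) → ∑[ i < n ] (f i - g i) ≈ ∑[ i < n ] f i - ∑[ i < n ] g i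
  ∑-distrib-sub {n} f g = begin
    ∑[ i < n ] (f i - g i)                 ≈⟨ sum-cong-≋ (λ i → +-congˡ (sym (-1*x≈-x (g i)))) ⟩
    ∑[ i < n ] (f i + - 1# * g i)          ≈⟨ ∑-distrib-+ f (λ i → - 1# * g i) ⟩
    ∑[ i < n ] f i + ∑[ i < n ] (- 1# * g i) ≈⟨ +-congˡ (sym (*-distribˡ-sum (- 1#) g)) ⟩
    ∑[ i < n ] f i + - 1# * ∑[ i < n ] g i ≈⟨ +-congˡ (-1*x≈-x _) ⟩
    ∑[ i < n ] f i - ∑[ i < n ] g i        ∎

  δ : ∀ {n} → Fin n → Fin n → Carrier
  δ a b = if ⌊ a Fin.≟ b ⌋ then 1# else 0#

  δ-suc : ∀ {n} (a b : Fin n) → δ (Fin.suc a) (Fin.suc b) ≡ δ a b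
  δ-suc a b with a Fin.≟ b
  ... | yes _ = ≡.refl
  ... | no _  = ≡.refl

  Matrix : ℕ → ℕ → Set c
  Matrix r s = Fin r → Fin s → Carrier

  _·_≈𝟙 : ∀ {r s} → Matrix r s → Matrix s r → Set ℓ
  _·_≈𝟙 {s = s} A B = ∀ a b → ∑[ x < s ] (A a x * B x b) ≈ δ a b

  module _ {r s} (A : Matrix (suc r) (suc s)) (B : Matrix (suc s) (suc r)) (AB≈𝟙 : A · B ≈𝟙)
           (p : Fin (suc s)) (pivot≉0 : ¬ B p Fin.zero ≈ 0#) where

    private
      ι : Carrier
      ι = proj₁ (inverse _ pivot≉0)

      κ : Fin r → Carrier
      κ b = ι * B p (Fin.suc b)

    reducedB : Matrix (suc s) r
    reducedB x b = B x (Fin.suc b) - B x Fin.zero * κ b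

    reducedB-pivot : ∀ b → reducedB p b ≈ 0#
    reducedB-pivot b = begin
      B p (Fin.suc b) - B p Fin.zero * (ι * B p (Fin.suc b)) ≈⟨ +-congˡ (-‿cong (sym (*-assoc _ _ _))) ⟩
      B p (Fin.suc b) - (B p Fin.zero * ι) * B p (Fin.suc b) ≈⟨ +-congˡ (-‿cong (*-congʳ (proj₂ (inverse _ pivot≉0)))) ⟩
      B p (Fin.suc b) - 1# * B p (Fin.suc b)                 ≈⟨ +-congˡ (-‿cong (*-identityˡ _)) ⟩
      B p (Fin.suc b) - B p (Fin.suc b)                      ≈⟨ -‿inverseʳ _ ⟩
      0#                                                     ∎

    tail·reducedB≈𝟙 : ∀ a b → ∑[ x < suc s ] (A (Fin.suc a) x * reducedB x b) ≈ δ a b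
    tail·reducedB≈𝟙 a b = begin
      ∑[ x < suc s ] (A a′ x * (B x (Fin.suc b) - B x Fin.zero * κ b))
        ≈⟨ sum-cong-≋ (λ x → trans (x[y-z]≈xy-xz (A a′ x) (B x (Fin.suc b)) (B x Fin.zero * κ b))
                                   (+-congˡ (-‿cong (sym (*-assoc (A a′ x) (B x Fin.zero) (κ b)))))) ⟩
      ∑[ x < suc s ] (A a′ x * B x (Fin.suc b) - A a′ x * B x Fin.zero * κ b)
        ≈⟨ ∑-distrib-sub (λ x → A a′ x * B x (Fin.suc b)) (λ x → A a′ x * B x Fin.zero * κ b) ⟩
      ∑[ x < suc s ] (A a′ x * B x (Fin.suc b)) - ∑[ x < suc s ] (A a′ x * B x Fin.zero * κ b)
        ≈⟨ +-congˡ (-‿cong (sym (*-distribʳ-sum (κ b) (λ x → A a′ x * B x Fin.zero)))) ⟩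
      ∑[ x < suc s ] (A a′ x * B x (Fin.suc b)) - ∑[ x < suc s ] (A a′ x * B x Fin.zero) * κ b
        ≈⟨ +-cong (AB≈𝟙 a′ (Fin.suc b)) (-‿cong (trans (*-congʳ (AB≈𝟙 a′ Fin.zero)) (zeroˡ _))) ⟩
      δ a′ (Fin.suc b) - 0#
        ≈⟨ trans (+-congˡ -0#≈0#) (+-identityʳ _) ⟩
      δ a′ (Fin.suc b)
        ≡⟨ δ-suc a b ⟩
      δ a b ∎
      where
      a′ = Fin.suc a

    eliminate-pivot : (λ a x → A (Fin.suc a) (punchIn p x)) · (λ x b → reducedB (punchIn p x) b) ≈𝟙
    eliminate-pivot a b = begin
      ∑[ x < s ] (A (Fin.suc a) (punchIn p x) * reducedB (punchIn p x) b)
        ≈⟨ sym (+-identityˡ _) ⟩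
      0# + ∑[ x < s ] (A (Fin.suc a) (punchIn p x) * reducedB (punchIn p x) b)
        ≈⟨ +-congʳ (sym (trans (*-congˡ (reducedB-pivot b)) (zeroʳ _))) ⟩
      A (Fin.suc a) p * reducedB p b + ∑[ x < s ] (A (Fin.suc a) (punchIn p x) * reducedB (punchIn p x) b)
        ≈⟨ sym (sum-remove {i = p} (λ x → A (Fin.suc a) x * reducedB x b)) ⟩
      ∑[ x < suc s ] (A (Fin.suc a) x * reducedB x b)
        ≈⟨ tail·reducedB≈𝟙 a b ⟩
      δ a b ∎

  -- Equality in F is undecidable, so the pivot search runs under a double
  -- negation: a nonzero entry in the first column of B can be eliminated,
  -- which by induction is absurd, so that column is (¬¬) zero, contradicting
  -- (A · B) 0 0 ≈ 1.
  no-𝟙-factorisation : ∀ r s (A : Matrix (suc r) s) B → s ≤ r → ¬ A · B ≈𝟙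
  no-𝟙-factorisation r zero A B _ AB≈𝟙 = 1≉0 (sym (AB≈𝟙 Fin.zero Fin.zero))
  no-𝟙-factorisation (suc r) (suc s) A B (s≤s s≤r) AB≈𝟙 =
    ¬¬-∀-Fin (suc s) (λ x → B x Fin.zero ≈ 0#) entry≈0 column≉0
    where
    entry≈0 : ∀ p → ¬ ¬ B p Fin.zero ≈ 0#
    entry≈0 p pivot≉0 = no-𝟙-factorisation r s _ _ s≤r (eliminate-pivot A B AB≈𝟙 p pivot≉0)
    column≉0 : ¬ (∀ x → B x Fin.zero ≈ 0#)
    column≉0 column≈0 = 1≉0 (begin
      1#
        ≈⟨ sym (AB≈𝟙 Fin.zero Fin.zero) ⟩
      ∑[ x < suc s ] (A Fin.zero x * B x Fin.zero)
        ≈⟨ ∑-zero (suc s) (λ x → A Fin.zero x * B x Fin.zero) (λ x → trans (*-congˡ (column≈0 x)) (zeroʳ _)) ⟩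
      0# ∎)

  𝟙-factorisation⇒≤ : ∀ r s (A : Matrix r s) B → A · B ≈𝟙 → r ≤ s
  𝟙-factorisation⇒≤ zero    s A B _ = z≤n
  𝟙-factorisation⇒≤ (suc r) s A B AB≈𝟙 with suc r ℕ.≤? s
  ... | yes r<s = r<s
  ... | no  r≮s = ⊥-elim (no-𝟙-factorisation r s A B (ℕₚ.≤-pred (ℕₚ.≰⇒> r≮s)) AB≈𝟙)

-- Layered branching programs

-- Vertices are addressed by their index in ℕ, with every weight outside a
-- layer equal to 0; this lets words be split without transporting along
-- equations between layer numbers.
module Layers {c ℓ : Level} (F : Field c ℓ) {m : ℕ} (A : ABP F m) where
  open Field F
  open Matrices F
  open import Relation.Binary.Reasoning.Setoid setoid

  labelℕ : ℕ → ℕ → ℕ → Fin m → Carrier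
  labelℕ i u v a with u ℕ.<? size A i | v ℕ.<? size A (suc i)
  ... | yes u< | yes v< = label A i (Fin.fromℕ< u<) (Fin.fromℕ< v<) a
  ... | _      | _      = 0#

  labelℕ-toℕ : ∀ i u v a → labelℕ i (toℕ u) (toℕ v) a ≡ label A i u v a
  labelℕ-toℕ i u v a with toℕ u ℕ.<? size A i | toℕ v ℕ.<? size A (suc i)
  ... | yes u< | yes v< = ≡.cong₂ (λ x y → label A i x y a) (Finₚ.fromℕ<-toℕ u u<) (Finₚ.fromℕ<-toℕ v v<)
  ... | no u≮   | _     = ⊥-elim (u≮ (Finₚ.toℕ<n u))
  ... | yes _  | no v≮  = ⊥-elim (v≮ (Finₚ.toℕ<n v))

  labelℕ-outside : ∀ i u v a → size A (suc i) ≤ v → labelℕ i u v a ≡ 0#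
  labelℕ-outside i u v a v≥ with u ℕ.<? size A i | v ℕ.<? size A (suc i)
  ... | yes _ | yes v< = ⊥-elim (ℕₚ.<⇒≱ v< v≥)
  ... | yes _ | no _   = ≡.refl
  ... | no _  | _      = ≡.refl

  δℕ : ℕ → ℕ → Carrier
  δℕ x y = if x ℕ.≡ᵇ y then 1# else 0#

  fwdℕ : List (Fin m) → ℕ → Carrier
  fwdℕ []       y = δℕ y (toℕ (source A))
  fwdℕ (a ∷ rw) y = ∑[ u < size A (length rw) ] (fwdℕ rw (toℕ u) * labelℕ (length rw) (toℕ u) y a)

  -- Sum over paths from vertex x of layer n to vertex y of layer n + |rv|,
  -- reading the reversed word rv.
  pathsℕ : ℕ → List (Fin m) → ℕ → ℕ → Carrier
  pathsℕ n []       x y = δℕ x y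
  pathsℕ n (a ∷ rv) x y =
    ∑[ z < size A (length rv ℕ.+ n) ] (pathsℕ n rv x (toℕ z) * labelℕ (length rv ℕ.+ n) (toℕ z) y a)

  fwd≈fwdℕ : ∀ rw v → fwd A rw v ≈ fwdℕ rw (toℕ v)
  fwd≈fwdℕ []       v = reflexive (≡.cong (λ b → if b then 1# else 0#) (⌊≟⌋≡≡ᵇ v (source A)))
  fwd≈fwdℕ (a ∷ rw) v = begin
    sumFin F _ (λ u → fwd A rw u * label A (length rw) u v a)
      ≡⟨ sumFin≡∑ _ (λ u → fwd A rw u * label A (length rw) u v a) ⟩
    ∑[ u < size A (length rw) ] (fwd A rw u * label A (length rw) u v a)
      ≈⟨ sum-cong-≋ (λ u → *-cong (fwd≈fwdℕ rw u) (reflexive (≡.sym (labelℕ-toℕ (length rw) u v a)))) ⟩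
    fwdℕ (a ∷ rw) (toℕ v) ∎

  fwdℕ-outside : ∀ rw y → size A (length rw) ≤ y → fwdℕ rw y ≈ 0#
  fwdℕ-outside []       y y≥ with y ℕ.≡ᵇ toℕ (source A) in eq
  ... | true  = ⊥-elim (ℕₚ.<⇒≱ (Finₚ.toℕ<n (source A))
                                (≡.subst (_ ≤_) (ℕₚ.≡ᵇ⇒≡ y _ (≡.subst T (≡.sym eq) _)) y≥))
  ... | false = refl
  fwdℕ-outside (a ∷ rw) y y≥ =
    ∑-zero (size A (length rw)) (λ u → fwdℕ rw (toℕ u) * labelℕ (length rw) (toℕ u) y a)
           (λ u → trans (*-congˡ (reflexive (labelℕ-outside (length rw) (toℕ u) y a y≥))) (zeroʳ _))

  ∑-δℕ : ∀ n (g : ℕ → Carrier) y → (n ≤ y → g y ≈ 0#) → ∑[ x < n ] (g (toℕ x) * δℕ (toℕ x) y) ≈ g y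
  ∑-δℕ zero    g y g≈0 = sym (g≈0 z≤n)
  ∑-δℕ (suc n) g zero g≈0 = begin
    g 0 * 1# + ∑[ x < n ] (g (suc (toℕ x)) * 0#) ≈⟨ +-cong (*-identityʳ _) (∑-zero n (λ x → g (suc (toℕ x)) * 0#) (λ x → zeroʳ _)) ⟩
    g 0 + 0#                                      ≈⟨ +-identityʳ _ ⟩
    g 0                                           ∎
  ∑-δℕ (suc n) g (suc y) g≈0 = begin
    g 0 * 0# + ∑[ x < n ] (g (suc (toℕ x)) * δℕ (toℕ x) y) ≈⟨ +-congʳ (zeroʳ _) ⟩
    0# + ∑[ x < n ] (g (suc (toℕ x)) * δℕ (toℕ x) y)       ≈⟨ +-identityˡ _ ⟩
    ∑[ x < n ] (g (suc (toℕ x)) * δℕ (toℕ x) y)            ≈⟨ ∑-δℕ n (g ∘ suc) y (g≈0 ∘ s≤s) ⟩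
    g (suc y)                                               ∎

  fwdℕ-++ : ∀ rv ru y →
    fwdℕ (rv ++ ru) y ≈ ∑[ x < size A (length ru) ] (fwdℕ ru (toℕ x) * pathsℕ (length ru) rv (toℕ x) y)
  fwdℕ-++ []       ru y = sym (∑-δℕ (size A (length ru)) (fwdℕ ru) y (fwdℕ-outside ru y))
  fwdℕ-++ (a ∷ rv) ru y rewrite Listₚ.length-++ rv {ru} = begin
    ∑[ u < N ] (fwdℕ (rv ++ ru) (toℕ u) * lab u)
      ≈⟨ sum-cong-≋ (λ u → trans (*-congʳ (fwdℕ-++ rv ru (toℕ u)))
                             (trans (*-distribʳ-sum (lab u) (λ x → f x * p x u)) (sum-cong-≋ (λ x → *-assoc (f x) (p x u) (lab u))))) ⟩
    ∑[ u < N ] ∑[ x < M ] (f x * (p x u * lab u))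
      ≈⟨ ∑-comm (λ u x → f x * (p x u * lab u)) ⟩
    ∑[ x < M ] ∑[ u < N ] (f x * (p x u * lab u))
      ≈⟨ sum-cong-≋ (λ x → sym (*-distribˡ-sum (f x) (λ u → p x u * lab u))) ⟩
    ∑[ x < M ] (f x * ∑[ u < N ] (p x u * lab u)) ∎
    where
    N = size A (length rv ℕ.+ length ru)
    M = size A (length ru)
    f : Fin M → Carrier
    f x = fwdℕ ru (toℕ x)
    p : Fin M → Fin N → Carrier
    p x u = pathsℕ (length ru) rv (toℕ x) (toℕ u)
    lab : Fin N → Carrier
    lab u = labelℕ (length rv ℕ.+ length ru) (toℕ u) y a

  toℕ-subst : ∀ {k k′} (e : k ≡ k′) {x : Fin (size A k)} → toℕ (≡.subst (λ j → Fin (size A j)) e x) ≡ toℕ x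
  toℕ-subst ≡.refl = ≡.refl

  computed-onLength : ∀ w → length w ≡ len A → computed A w ≈ fwdℕ (reverse w) (toℕ (sink A))
  computed-onLength w e with length (reverse w) ℕ.≟ len A
  ... | yes e′ = trans (fwd≈fwdℕ (reverse w) _) (reflexive (≡.cong (fwdℕ (reverse w)) (toℕ-subst (≡.sym e′))))
  ... | no  e≢ = ⊥-elim (e≢ (≡.trans (Listₚ.length-reverse w) e))

  computed-offLength : ∀ w → ¬ length w ≡ len A → computed A w ≡ 0#
  computed-offLength w e≢ with length (reverse w) ℕ.≟ len A
  ... | yes e = ⊥-elim (e≢ (≡.trans (≡.sym (Listₚ.length-reverse w)) e))
  ... | no _  = ≡.refl

  computed-through-layer : ∀ u v i → length u ≡ i → length (u ++ v) ≡ len A →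
    computed A (u ++ v) ≈ ∑[ x < size A i ] (fwdℕ (reverse u) (toℕ x) * pathsℕ i (reverse v) (toℕ x) (toℕ (sink A)))
  computed-through-layer u v i |u|≡i e = begin
    computed A (u ++ v)                                ≈⟨ computed-onLength (u ++ v) e ⟩
    fwdℕ (reverse (u ++ v)) (toℕ (sink A))             ≡⟨ ≡.cong (λ z → fwdℕ z (toℕ (sink A))) (Listₚ.reverse-++ u v) ⟩
    fwdℕ (reverse v ++ reverse u) (toℕ (sink A))       ≈⟨ fwdℕ-++ (reverse v) (reverse u) (toℕ (sink A)) ⟩
    ∑[ x < size A (length (reverse u)) ] (fwdℕ (reverse u) (toℕ x) * pathsℕ (length (reverse u)) (reverse v) (toℕ x) (toℕ (sink A)))
      ≡⟨ ≡.cong (λ k → ∑[ x < size A k ] (fwdℕ (reverse u) (toℕ x) * pathsℕ k (reverse v) (toℕ x) (toℕ (sink A))))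
                (≡.trans (Listₚ.length-reverse u) |u|≡i) ⟩
    ∑[ x < size A i ] (fwdℕ (reverse u) (toℕ x) * pathsℕ i (reverse v) (toℕ x) (toℕ (sink A))) ∎

-- Complete binary trees, masks and cuts

treeSize : ℕ → ℕ
treeSize zero    = 1
treeSize (suc d) = treeSize d ℕ.+ suc (treeSize d)

length-inorder : ∀ {m d} (t : CTree m d) → length (inorder t) ≡ treeSize d
length-inorder (leaf a)     = ≡.refl
length-inorder (node l a r) =
  ≡.trans (Listₚ.length-++ (inorder l)) (≡.cong₂ ℕ._+_ (length-inorder l) (≡.cong suc (length-inorder r)))

++-injective : ∀ {A : Set} (xs ys xs′ ys′ : List A) → length xs ≡ length xs′ →
               xs ++ ys ≡ xs′ ++ ys′ → xs ≡ xs′ × ys ≡ ys′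
++-injective []       ys []         ys′ _  e = ≡.refl , e
++-injective (x ∷ xs) ys (x′ ∷ xs′) ys′ el e
  with ++-injective xs ys xs′ ys′ (ℕₚ.suc-injective el) (Listₚ.∷-injectiveʳ e)
... | xs≡ , ys≡ = ≡.cong₂ _∷_ (Listₚ.∷-injectiveˡ e) xs≡ , ys≡

inorder-injective : ∀ {m d} (t t′ : CTree m d) → inorder t ≡ inorder t′ → t ≡ t′
inorder-injective (leaf a) (leaf a′) e = ≡.cong leaf (Listₚ.∷-injectiveˡ e)
inorder-injective (node l a r) (node l′ a′ r′) e
  with ++-injective (inorder l) _ (inorder l′) _ (≡.trans (length-inorder l) (≡.sym (length-inorder l′))) e
... | l≡ , ar≡ = ≡.cong₂ (λ f x → f x)
                   (≡.cong₂ node (inorder-injective l l′ l≡) (Listₚ.∷-injectiveˡ ar≡))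
                   (inorder-injective r r′ (Listₚ.∷-injectiveʳ ar≡))

treeSize≡nodes : ∀ d → treeSize d ≡ nodes d
treeSize≡nodes d = ≡.cong (ℕ._∸ 1) (suc-treeSize d)
  where
  open ≡.≡-Reasoning
  suc-treeSize : ∀ d → suc (treeSize d) ≡ 2 ^ suc d
  suc-treeSize zero    = ≡.refl
  suc-treeSize (suc d) = begin
    suc (treeSize d ℕ.+ suc (treeSize d))  ≡⟨ ≡.cong suc (ℕₚ.+-suc (treeSize d) (treeSize d)) ⟩
    suc (suc (treeSize d ℕ.+ treeSize d))  ≡⟨ ≡.cong suc (ℕₚ.+-suc (treeSize d) (treeSize d)) ⟨
    suc (treeSize d) ℕ.+ suc (treeSize d)  ≡⟨ ≡.cong (λ n → n ℕ.+ n) (suc-treeSize d) ⟩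
    2 ^ suc d ℕ.+ 2 ^ suc d                ≡⟨ ≡.cong (2 ^ suc d ℕ.+_) (ℕₚ.+-identityʳ (2 ^ suc d)) ⟨
    2 ^ suc (suc d)                        ∎

data Tree (A : Set) : ℕ → Set where
  leaf : A → Tree A 0
  node : ∀ {d} → Tree A d → A → Tree A d → Tree A (suc d)

top : ∀ {A d} → Tree A d → A
top (leaf a)     = a
top (node _ a _) = a

mapTree : ∀ {A B : Set} {d} → (A → B) → Tree A d → Tree B d
mapTree f (leaf a)     = leaf (f a)
mapTree f (node l a r) = node (mapTree f l) (f a) (mapTree f r)

inorderTree : ∀ {A : Set} {d} → Tree A d → List A
inorderTree (leaf a)     = a ∷ []
inorderTree (node l a r) = inorderTree l ++ (a ∷ inorderTree r)

AllNodes : ∀ {A : Set} {d} → (A → Set) → Tree A d → Set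
AllNodes P (leaf a)     = P a
AllNodes P (node l a r) = AllNodes P l × P a × AllNodes P r

AnyNode : ∀ {A : Set} {d} → (A → Set) → Tree A d → Set
AnyNode P (leaf a)     = P a
AnyNode P (node l a r) = AnyNode P l ⊎ P a ⊎ AnyNode P r

any-top : ∀ {A : Set} {d} {P : A → Set} (t : Tree A d) → P (top t) → AnyNode P t
any-top (leaf a)     p = p
any-top (node l a r) p = inj₂ (inj₁ p)

any-mono : ∀ {A : Set} {d} {P Q : A → Set} (t : Tree A d) → (∀ {x} → P x → Q x) → AnyNode P t → AnyNode Q t
any-mono (leaf a)     P⇒Q p                = P⇒Q p
any-mono (node l a r) P⇒Q (inj₁ p)         = inj₁ (any-mono l P⇒Q p)
any-mono (node l a r) P⇒Q (inj₂ (inj₁ p))  = inj₂ (inj₁ (P⇒Q p))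
any-mono (node l a r) P⇒Q (inj₂ (inj₂ p))  = inj₂ (inj₂ (any-mono r P⇒Q p))

any-mapTree : ∀ {A B : Set} {d} {P : B → Set} (f : A → B) (t : Tree A d) → AnyNode (λ x → P (f x)) t → AnyNode P (mapTree f t)
any-mapTree f (leaf a)     p               = p
any-mapTree f (node l a r) (inj₁ p)        = inj₁ (any-mapTree f l p)
any-mapTree f (node l a r) (inj₂ (inj₁ p)) = inj₂ (inj₁ p)
any-mapTree f (node l a r) (inj₂ (inj₂ p)) = inj₂ (inj₂ (any-mapTree f r p))

all∧any⇒∃ : ∀ {A : Set} {d} {P Q : A → Set} (t : Tree A d) → AllNodes P t → AnyNode Q t → Σ A λ x → P x × Q x
all∧any⇒∃ (leaf a)     p               q               = a , p , q
all∧any⇒∃ (node l a r) (pl , _ , _)   (inj₁ q)        = all∧any⇒∃ l pl q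
all∧any⇒∃ (node l a r) (_ , pa , _)   (inj₂ (inj₁ q)) = a , pa , q
all∧any⇒∃ (node l a r) (_ , _ , pr)   (inj₂ (inj₂ q)) = all∧any⇒∃ r pr q

Mask : ℕ → Set
Mask = Tree Bool

Constant : ∀ {d} → Bool → Mask d → Set
Constant τ M = AllNodes (_≡ τ) M

Mixed : ∀ {d} → Mask d → Set
Mixed M = AnyNode (_≡ true) M × AnyNode (_≡ false) M

constant-any : ∀ {d} τ β (M : Mask d) → Constant τ M → AnyNode (_≡ β) M → τ ≡ β
constant-any τ β M τ-const β-somewhere with all∧any⇒∃ M τ-const β-somewhere
... | _ , ≡.refl , ≡.refl = ≡.refl

constant⇒¬mixed : ∀ {d} τ (M : Mask d) → Constant τ M → ¬ Mixed M
constant⇒¬mixed τ M τ-const (t , f) with ≡.trans (≡.sym (constant-any τ true M τ-const t)) (constant-any τ false M τ-const f)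
... | ()

mixed-of-≢ : ∀ {d} (M : Mask d) {x y} → x ≢ y → AnyNode (_≡ x) M → AnyNode (_≡ y) M → Mixed M
mixed-of-≢ M {true}  {true}  x≢y _ _ = ⊥-elim (x≢y ≡.refl)
mixed-of-≢ M {false} {false} x≢y _ _ = ⊥-elim (x≢y ≡.refl)
mixed-of-≢ M {true}  {false} _   p q = p , q
mixed-of-≢ M {false} {true}  _   p q = q , p

constant-or-mixed : ∀ {d} (M : Mask d) → Constant (top M) M ⊎ Mixed M
constant-or-mixed (leaf a) = inj₁ ≡.refl
constant-or-mixed (node l a r) with constant-or-mixed l | constant-or-mixed r
... | inj₂ (t , f) | _            = inj₂ (inj₁ t , inj₁ f)
... | inj₁ _       | inj₂ (t , f) = inj₂ (inj₂ (inj₂ t) , inj₂ (inj₂ f))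
... | inj₁ l-const | inj₁ r-const with top l ≟ᴮ a | top r ≟ᴮ a
...   | yes ≡.refl | yes r≡a = inj₁ (l-const , ≡.refl , ≡.subst (λ τ → Constant τ r) r≡a r-const)
...   | no  l≢a    | _       = inj₂ (mixed-of-≢ (node l a r) (l≢a ∘ ≡.sym) (inj₂ (inj₁ ≡.refl)) (inj₁ (any-top l ≡.refl)))
...   | yes _      | no  r≢a =
  inj₂ (mixed-of-≢ (node l a r) (r≢a ∘ ≡.sym) (inj₂ (inj₁ ≡.refl)) (inj₂ (inj₂ (any-top r ≡.refl))))

module _ {A : Set} where
  open ≡ using (refl; cong; cong₂)

  inorderTree-mapTree : ∀ {B : Set} {d} (f : B → A) (t : Tree B d) → inorderTree (mapTree f t) ≡ List.map f (inorderTree t)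
  inorderTree-mapTree f (leaf a)     = refl
  inorderTree-mapTree f (node l a r) =
    ≡.trans (cong₂ (λ u v → u ++ (f a ∷ v)) (inorderTree-mapTree f l) (inorderTree-mapTree f r))
            (≡.sym (Listₚ.map-++ f (inorderTree l) _))

  length-inorderTree : ∀ {d} (t : Tree A d) → length (inorderTree t) ≡ treeSize d
  length-inorderTree (leaf a)     = refl
  length-inorderTree (node l a r) =
    ≡.trans (Listₚ.length-++ (inorderTree l)) (cong₂ ℕ._+_ (length-inorderTree l) (cong suc (length-inorderTree r)))

  build : ∀ d → ℕ → (ℕ → A) → Tree A d
  build zero    off f = leaf (f off)
  build (suc d) off f = node (build d off f) (f (off ℕ.+ treeSize d)) (build d (off ℕ.+ suc (treeSize d)) f)

  inorderTree-build : ∀ d off (f : ℕ → A) → inorderTree (build d off f) ≡ List.applyUpTo (λ k → f (off ℕ.+ k)) (treeSize d)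
  inorderTree-build zero    off f = cong (λ x → f x ∷ []) (≡.sym (ℕₚ.+-identityʳ off))
  inorderTree-build (suc d) off f = begin
    inorderTree (build d off f) ++ (f (off ℕ.+ treeSize d) ∷ inorderTree (build d (off ℕ.+ suc (treeSize d)) f))
      ≡⟨ cong₂ (λ u v → u ++ (f (off ℕ.+ treeSize d) ∷ v)) (inorderTree-build d off f) (inorderTree-build d _ f) ⟩
    List.applyUpTo (λ k → f (off ℕ.+ k)) (treeSize d) ++
      (f (off ℕ.+ treeSize d) ∷ List.applyUpTo (λ k → f (off ℕ.+ suc (treeSize d) ℕ.+ k)) (treeSize d))
      ≡⟨ cong (λ v → List.applyUpTo (λ k → f (off ℕ.+ k)) (treeSize d) ++ v)
              (cong₂ _∷_ (cong (λ k → f (off ℕ.+ k)) (≡.sym (ℕₚ.+-identityʳ (treeSize d))))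
                         (applyUpTo-cong (treeSize d) (λ k → cong f (shift k)))) ⟩
    List.applyUpTo (λ k → f (off ℕ.+ k)) (treeSize d) ++ List.applyUpTo (λ k → f (off ℕ.+ (treeSize d ℕ.+ k))) (suc (treeSize d))
      ≡⟨ applyUpTo-+ (λ k → f (off ℕ.+ k)) (treeSize d) (suc (treeSize d)) ⟨
    List.applyUpTo (λ k → f (off ℕ.+ k)) (treeSize d ℕ.+ suc (treeSize d)) ∎
    where
    open ≡.≡-Reasoning
    shift : ∀ k → off ℕ.+ suc (treeSize d) ℕ.+ k ≡ off ℕ.+ (treeSize d ℕ.+ suc k)
    shift k = ≡.trans (ℕₚ.+-assoc off (suc (treeSize d)) k) (cong (off ℕ.+_) (≡.sym (ℕₚ.+-suc (treeSize d) k)))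

  all-build : ∀ (P : A → Set) d off (f : ℕ → A) → (∀ k → k < treeSize d → P (f (off ℕ.+ k))) → AllNodes P (build d off f)
  all-build P zero    off f Pf = ≡.subst (P ∘ f) (ℕₚ.+-identityʳ off) (Pf 0 (s≤s z≤n))
  all-build P (suc d) off f Pf =
    all-build P d off f (λ k k< → Pf k (ℕₚ.<-≤-trans k< (ℕₚ.m≤m+n _ _))) ,
    Pf (treeSize d) (ℕₚ.m<m+n _ (s≤s z≤n)) ,
    all-build P d _ f (λ k k< → ≡.subst (P ∘ f) (≡.sym (shift k)) (Pf (suc (treeSize d) ℕ.+ k)
                       (≡.subst (suc (treeSize d) ℕ.+ k <_) (ℕₚ.+-comm (suc (treeSize d)) (treeSize d)) (ℕₚ.+-monoʳ-< _ k<))))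
    where
    shift : ∀ k → off ℕ.+ suc (treeSize d) ℕ.+ k ≡ off ℕ.+ (suc (treeSize d) ℕ.+ k)
    shift k = ℕₚ.+-assoc off (suc (treeSize d)) k

  top-build : ∀ d off (f : ℕ → A) → Σ ℕ λ k → k < treeSize d × top (build d off f) ≡ f (off ℕ.+ k)
  top-build zero    off f = 0 , s≤s z≤n , cong f (≡.sym (ℕₚ.+-identityʳ off))
  top-build (suc d) off f = treeSize d , ℕₚ.m<m+n _ (s≤s z≤n) , refl

marks : ℕ → ∀ {d} → Tree ℕ d → Mask d
marks i = mapTree (ℕ._<ᵇ i)

SomeBefore SomeFrom Straddles : ℕ → ∀ {d} → Tree ℕ d → Set
SomeBefore i = AnyNode (_< i)
SomeFrom   i = AnyNode (i ≤_)
Straddles  i X = SomeBefore i X × SomeFrom i X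

marked-of-before : ∀ {d} i (X : Tree ℕ d) → SomeBefore i X → AnyNode (_≡ true) (marks i X)
marked-of-before i X = any-mapTree (ℕ._<ᵇ i) X ∘ any-mono X (Equivalence.to T-≡ ∘ ℕₚ.<⇒<ᵇ)

unmarked-of-from : ∀ {d} i (X : Tree ℕ d) → SomeFrom i X → AnyNode (_≡ false) (marks i X)
unmarked-of-from i X = any-mapTree (ℕ._<ᵇ i) X ∘ any-mono X ≮ᵇ
  where
  ≮ᵇ : ∀ {x} → i ≤ x → (x ℕ.<ᵇ i) ≡ false
  ≮ᵇ {x} i≤x with x ℕ.<ᵇ i in eq
  ... | false = ≡.refl
  ... | true  = ⊥-elim (ℕₚ.<⇒≱ (ℕₚ.<ᵇ⇒< x i (≡.subst T (≡.sym eq) _)) i≤x)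

mixed-of-straddles : ∀ {d} i (X : Tree ℕ d) → Straddles i X → Mixed (marks i X)
mixed-of-straddles i X (before , from) = marked-of-before i X before , unmarked-of-from i X from

Separated : ℕ → ∀ {d} → Tree ℕ d → Tree ℕ d → Set
Separated i X Y = (SomeBefore i X × SomeFrom i Y) ⊎ (SomeBefore i Y × SomeFrom i X)

separated⇒¬constant : ∀ {d} i (X Y : Tree ℕ d) → Separated i X Y →
                      ∀ τ → Constant τ (marks i X) → Constant τ (marks i Y) → ⊥
separated⇒¬constant i X Y (inj₁ (before , from)) τ constX constY
  with ≡.trans (≡.sym (constant-any τ true (marks i X) constX (marked-of-before i X before)))
               (constant-any τ false (marks i Y) constY (unmarked-of-from i Y from))
... | ()
separated⇒¬constant i X Y (inj₂ (before , from)) τ constX constY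
  with ≡.trans (≡.sym (constant-any τ true (marks i Y) constY (marked-of-before i Y before)))
               (constant-any τ false (marks i X) constX (unmarked-of-from i X from))
... | ()

_∈[_,_] : ℕ → ℕ → ℕ → Set
x ∈[ y , z ] = (y ≤ x × x ≤ z) ⊎ (z ≤ x × x ≤ y)

median : ∀ a b c → a ∈[ b , c ] ⊎ b ∈[ a , c ] ⊎ c ∈[ a , b ]
median a b c with ℕₚ.≤-total a b | ℕₚ.≤-total b c | ℕₚ.≤-total a c
... | inj₁ a≤b | inj₁ b≤c | _        = inj₂ (inj₁ (inj₁ (a≤b , b≤c)))
... | inj₁ a≤b | inj₂ c≤b | inj₁ a≤c = inj₂ (inj₂ (inj₁ (a≤c , c≤b)))
... | inj₁ a≤b | inj₂ c≤b | inj₂ c≤a = inj₁ (inj₂ (c≤a , a≤b))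
... | inj₂ b≤a | inj₁ b≤c | inj₁ a≤c = inj₁ (inj₁ (b≤a , a≤c))
... | inj₂ b≤a | inj₁ b≤c | inj₂ c≤a = inj₂ (inj₂ (inj₂ (b≤c , c≤a)))
... | inj₂ b≤a | inj₂ c≤b | _        = inj₂ (inj₁ (inj₂ (c≤b , b≤a)))

separated-at-median : ∀ {d} {x y z} (Y Z : Tree ℕ d) → x ∈[ y , z ] → Straddles y Y → Straddles z Z → Separated x Y Z
separated-at-median Y Z (inj₁ (y≤x , x≤z)) (beforeY , _) (_ , fromZ) =
  inj₁ (any-mono Y (λ lt → ℕₚ.<-≤-trans lt y≤x) beforeY , any-mono Z (λ le → ℕₚ.≤-trans x≤z le) fromZ)
separated-at-median Y Z (inj₂ (z≤x , x≤y)) (_ , fromY) (beforeZ , _) =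
  inj₂ (any-mono Z (λ lt → ℕₚ.<-≤-trans lt z≤x) beforeZ , any-mono Y (λ le → ℕₚ.≤-trans x≤y le) fromY)

DistinctFromLeftChild : ∀ {d} → Tree ℕ d → Set
DistinctFromLeftChild (leaf _)     = ⊤
DistinctFromLeftChild (node l t r) = t ≢ top l × DistinctFromLeftChild l × DistinctFromLeftChild r

straddled : ∀ {d} (X : Tree ℕ (suc d)) → DistinctFromLeftChild X → Σ ℕ λ i → Straddles i X
straddled (node l t r) (t≢ , _) with t ℕ.<? top l
... | yes t<l = top l , inj₂ (inj₁ t<l) , inj₁ (any-top l ℕₚ.≤-refl)
... | no  t≮l = t , inj₁ (any-top l (ℕₚ.≤∧≢⇒< (ℕₚ.≮⇒≥ t≮l) (t≢ ∘ ≡.sym))) , inj₂ (inj₁ ℕₚ.≤-refl)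

distinct-build : ∀ d off (f : ℕ → ℕ) → (∀ {x y} → f x ≡ f y → x ≡ y) → DistinctFromLeftChild (build d off f)
distinct-build zero    off f f-inj = _
distinct-build (suc d) off f f-inj with top-build d off f
... | k , k< , top≡ =
  (λ e → ℕₚ.<-irrefl (≡.sym (ℕₚ.+-cancelˡ-≡ off _ _ (f-inj (≡.trans e top≡)))) k<) ,
  distinct-build d off f f-inj , distinct-build d _ f f-inj

-- Colourings of T_d and fooling families

module CoefficientsOfPd {c ℓ : Level} (F : Field c ℓ) where
  open Field F
  open Matrices F
  open import Relation.Binary.Reasoning.Setoid setoid

  listSum : ∀ {X : Set} → (X → Carrier) → List X → Carrier
  listSum f = List.foldr (λ x acc → f x + acc) 0#

  listSum-cong : ∀ {X : Set} {f g : X → Carrier} xs → (∀ x → f x ≈ g x) → listSum f xs ≈ listSum g xs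
  listSum-cong []       f≈g = refl
  listSum-cong (x ∷ xs) f≈g = +-cong (f≈g x) (listSum-cong xs f≈g)

  listSum-zero : ∀ {X : Set} {f : X → Carrier} xs → (∀ x → f x ≈ 0#) → listSum f xs ≈ 0#
  listSum-zero []       f≈0 = refl
  listSum-zero (x ∷ xs) f≈0 = trans (+-cong (f≈0 x) (listSum-zero xs f≈0)) (+-identityʳ 0#)

  listSum-++ : ∀ {X : Set} (f : X → Carrier) xs ys → listSum f (xs ++ ys) ≈ listSum f xs + listSum f ys
  listSum-++ f []       ys = sym (+-identityˡ _)
  listSum-++ f (x ∷ xs) ys = trans (+-congˡ (listSum-++ f xs ys)) (sym (+-assoc _ _ _))

  listSum-map : ∀ {X Y : Set} (f : Y → Carrier) (g : X → Y) xs → listSum f (List.map g xs) ≡ listSum (λ x → f (g x)) xs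
  listSum-map f g []       = ≡.refl
  listSum-map f g (x ∷ xs) = ≡.cong (f (g x) +_) (listSum-map f g xs)

  listSum-concatMap : ∀ {X Y : Set} (f : Y → Carrier) (g : X → List Y) xs →
                      listSum f (List.concatMap g xs) ≈ listSum (λ x → listSum f (g x)) xs
  listSum-concatMap f g []       = refl
  listSum-concatMap f g (x ∷ xs) = trans (listSum-++ f (g x) (List.concatMap g xs)) (+-congˡ (listSum-concatMap f g xs))

  listSum-tabulate : ∀ {X : Set} n (g : Fin n → X) (f : X → Carrier) → listSum f (List.tabulate g) ≈ ∑[ i < n ] f (g i)
  listSum-tabulate zero    g f = refl
  listSum-tabulate (suc n) g f = +-congˡ (listSum-tabulate n (λ i → g (Fin.suc i)) f)

  listSum-allFinL-single : ∀ n (a : Fin n) (f : Fin n → Carrier) → (∀ y → y ≢ a → f y ≈ 0#) →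
                           listSum f (allFinL n) ≈ f a
  listSum-allFinL-single (suc n) a f f≈0 = begin
    listSum f (allFinL (suc n))          ≈⟨ listSum-tabulate (suc n) (λ i → i) f ⟩
    ∑[ i < suc n ] f i                   ≈⟨ sum-remove {i = a} f ⟩
    f a + ∑[ x < n ] f (punchIn a x)     ≈⟨ +-congˡ (∑-zero n (λ x → f (punchIn a x)) (λ x → f≈0 _ (Finₚ.punchInᵢ≢i a x))) ⟩
    f a + 0#                             ≈⟨ +-identityʳ _ ⟩
    f a                                  ∎

  listSum-allCTrees-single : ∀ m d (t : CTree m d) (f : CTree m d → Carrier) → (∀ y → y ≢ t → f y ≈ 0#) →
                             listSum f (allCTrees m d) ≈ f t
  listSum-allCTrees-single m zero (leaf a) f f≈0 = begin
    listSum f (List.map leaf (allFinL m))  ≡⟨ listSum-map f leaf (allFinL m) ⟩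
    listSum (λ x → f (leaf x)) (allFinL m) ≈⟨ listSum-allFinL-single m a (λ x → f (leaf x)) (λ y y≢a → f≈0 _ (y≢a ∘ leaf-injective)) ⟩
    f (leaf a)                             ∎
    where
    leaf-injective : ∀ {x y} → leaf {m} x ≡ leaf y → x ≡ y
    leaf-injective ≡.refl = ≡.refl
  listSum-allCTrees-single m (suc d) (node l a r) f f≈0 = begin
    listSum f (allCTrees m (suc d))
      ≈⟨ listSum-concatMap f _ (allCTrees m d) ⟩
    listSum (λ l′ → listSum f (List.concatMap (λ a′ → List.map (node l′ a′) (allCTrees m d)) (allFinL m))) (allCTrees m d)
      ≈⟨ listSum-cong (allCTrees m d) (λ l′ → trans (listSum-concatMap f _ (allFinL m))
           (listSum-cong (allFinL m) (λ a′ → reflexive (listSum-map f (node l′ a′) (allCTrees m d))))) ⟩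
    listSum sumOver (allCTrees m d)
      ≈⟨ listSum-allCTrees-single m d l sumOver (λ l′ l′≢l → listSum-zero (allFinL m) λ a′ →
           listSum-zero (allCTrees m d) λ r′ → f≈0 _ λ { ≡.refl → l′≢l ≡.refl }) ⟩
    sumOver l
      ≈⟨ listSum-allFinL-single m a (λ a′ → listSum (λ r′ → f (node l a′ r′)) (allCTrees m d)) (λ a′ a′≢a →
           listSum-zero (allCTrees m d) λ r′ → f≈0 _ λ { ≡.refl → a′≢a ≡.refl }) ⟩
    listSum (λ r′ → f (node l a r′)) (allCTrees m d)
      ≈⟨ listSum-allCTrees-single m d r (λ r′ → f (node l a r′)) (λ r′ r′≢r → f≈0 _ λ { ≡.refl → r′≢r ≡.refl }) ⟩
    f (node l a r) ∎
    where
    sumOver : CTree m d → Carrier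
    sumOver l′ = listSum (λ a′ → listSum (λ r′ → f (node l′ a′ r′)) (allCTrees m d)) (allFinL m)

  Pd-inorder : ∀ m .{{_ : NonZero m}} d (t : CTree m d) → Pd F m d (inorder t) ≈ (if legal t then 1# else 0#)
  Pd-inorder m d t = trans (listSum-allCTrees-single m d t term term≈0) (reflexive (≡.cong (λ b → if b then 1# else 0#) legal∧≡))
    where
    term : CTree m d → Carrier
    term t′ = if legal t′ ∧ ⌊ Listₚ.≡-dec Fin._≟_ (inorder t′) (inorder t) ⌋ then 1# else 0#
    legal∧≡ : (legal t ∧ ⌊ Listₚ.≡-dec Fin._≟_ (inorder t) (inorder t) ⌋) ≡ legal t
    legal∧≡ with Listₚ.≡-dec Fin._≟_ (inorder t) (inorder t)
    ... | yes _  = ∧-identityʳ (legal t)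
    ... | no  ≢t = ⊥-elim (≢t ≡.refl)
    term≈0 : ∀ t′ → t′ ≢ t → term t′ ≈ 0#
    term≈0 t′ t′≢t with Listₚ.≡-dec Fin._≟_ (inorder t′) (inorder t)
    ... | yes e = ⊥-elim (t′≢t (inorder-injective t′ t e))
    ... | no  _ with legal t′
    ...   | true  = refl
    ...   | false = refl

module Colourings (m′ : ℕ) where
  open import Data.Nat.DivMod using (_%_; _mod_; %-distribˡ-+; %-remove-+ˡ; m<n⇒m%n≡m)
  open import Data.Nat.Divisibility using (∣-refl)
  open import Data.Vec as Vec using (Vec; []; _∷_)
  import Data.Vec.Properties as Vecₚ
  open import Relation.Nullary.Decidable using (toWitness; fromWitness)
  open ≡ using (refl; cong; cong₂; sym; trans; subst)
  open ≡.≡-Reasoning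

  m : ℕ
  m = suc m′

  CT : ℕ → Set
  CT = CTree m

  toℕ-+ₘ : ∀ (a b : Fin m) → toℕ (a +ₘ b) ≡ (toℕ a ℕ.+ toℕ b) % m
  toℕ-+ₘ a b = Finₚ.toℕ-fromℕ< _

  +ₘ-identityʳ : ∀ (a : Fin m) → a +ₘ Fin.zero ≡ a
  +ₘ-identityʳ a = Finₚ.toℕ-injective (begin
    toℕ (a +ₘ Fin.zero)     ≡⟨ toℕ-+ₘ a Fin.zero ⟩
    (toℕ a ℕ.+ 0) % m       ≡⟨ cong (_% m) (ℕₚ.+-identityʳ (toℕ a)) ⟩
    toℕ a % m               ≡⟨ m<n⇒m%n≡m (Finₚ.toℕ<n a) ⟩
    toℕ a                   ∎)

  +ₘ-comm : ∀ (a b : Fin m) → a +ₘ b ≡ b +ₘ a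
  +ₘ-comm a b = cong (_mod m) (ℕₚ.+-comm (toℕ a) (toℕ b))

  +ₘ-cancelˡ : ∀ (a : Fin m) {b b′} → a +ₘ b ≡ a +ₘ b′ → b ≡ b′
  +ₘ-cancelˡ a {b} {b′} e = Finₚ.toℕ-injective (begin
    toℕ b                              ≡⟨ m<n⇒m%n≡m (Finₚ.toℕ<n b) ⟨
    toℕ b % m                          ≡⟨ unshift (toℕ b) ⟨
    (m ∸ x ℕ.+ (x ℕ.+ toℕ b)) % m      ≡⟨ %-distribˡ-+ (m ∸ x) _ m ⟩
    (((m ∸ x) % m) ℕ.+ (x ℕ.+ toℕ b) % m) % m
      ≡⟨ cong (λ y → ((m ∸ x) % m ℕ.+ y) % m) (trans (sym (toℕ-+ₘ a b)) (trans (cong toℕ e) (toℕ-+ₘ a b′))) ⟩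
    (((m ∸ x) % m) ℕ.+ (x ℕ.+ toℕ b′) % m) % m ≡⟨ %-distribˡ-+ (m ∸ x) _ m ⟨
    (m ∸ x ℕ.+ (x ℕ.+ toℕ b′)) % m     ≡⟨ unshift (toℕ b′) ⟩
    toℕ b′ % m                         ≡⟨ m<n⇒m%n≡m (Finₚ.toℕ<n b′) ⟩
    toℕ b′                             ∎)
    where
    x = toℕ a
    unshift : ∀ y → (m ∸ x ℕ.+ (x ℕ.+ y)) % m ≡ y % m
    unshift y = begin
      (m ∸ x ℕ.+ (x ℕ.+ y)) % m  ≡⟨ cong (_% m) (ℕₚ.+-assoc (m ∸ x) x y) ⟨
      (m ∸ x ℕ.+ x ℕ.+ y) % m    ≡⟨ cong (λ z → (z ℕ.+ y) % m) (ℕₚ.m∸n+n≡m (ℕₚ.<⇒≤ (Finₚ.toℕ<n a))) ⟩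
      (m ℕ.+ y) % m              ≡⟨ %-remove-+ˡ y ∣-refl ⟩
      y % m                      ∎

  +ₘ-cancelʳ : ∀ {a a′} (b : Fin m) → a +ₘ b ≡ a′ +ₘ b → a ≡ a′
  +ₘ-cancelʳ {a} {a′} b e = +ₘ-cancelˡ b (trans (+ₘ-comm b a) (trans e (+ₘ-comm a′ b)))

  join : ∀ {d} → CT d → CT d → CT (suc d)
  join l r = node l (root l +ₘ root r) r

  legal-join : ∀ {d} (l r : CT d) → T (legal l) → T (legal r) → T (legal (join l r))
  legal-join l r legal-l legal-r =
    Equivalence.from T-∧ (legal-l , Equivalence.from T-∧ (fromWitness {a? = (root l +ₘ root r) Fin.≟ _} refl , legal-r))

  childˡ childʳ : ∀ {d} → CT (suc d) → CT d
  childˡ (node l _ _) = l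
  childʳ (node _ _ r) = r

  legal-node : ∀ {d} (t : CT (suc d)) → T (legal t) →
               T (legal (childˡ t)) × root t ≡ root (childˡ t) +ₘ root (childʳ t) × T (legal (childʳ t))
  legal-node (node l a r) legal-lar with Equivalence.to T-∧ legal-lar
  ... | legal-l , rest with Equivalence.to T-∧ rest
  ...   | a≡ , legal-r = legal-l , toWitness {a? = a Fin.≟ (root l +ₘ root r)} a≡ , legal-r

  zeros : ∀ d → CT d
  zeros zero    = leaf Fin.zero
  zeros (suc d) = join (zeros d) (zeros d)

  root-zeros : ∀ d → root (zeros d) ≡ Fin.zero
  root-zeros zero    = refl
  root-zeros (suc d) rewrite root-zeros d = +ₘ-identityʳ Fin.zero

  legal-zeros : ∀ d → T (legal (zeros d))
  legal-zeros zero    = _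
  legal-zeros (suc d) = legal-join (zeros d) (zeros d) (legal-zeros d) (legal-zeros d)

  spine : ∀ d → Fin m → CT d
  spine zero    c = leaf c
  spine (suc d) c = join (spine d c) (zeros d)

  root-spine : ∀ d c → root (spine d c) ≡ c
  root-spine zero    c = refl
  root-spine (suc d) c rewrite root-zeros d | root-spine d c = +ₘ-identityʳ c

  legal-spine : ∀ d c → T (legal (spine d c))
  legal-spine zero    c = _
  legal-spine (suc d) c = legal-join (spine d c) (zeros d) (legal-spine d c) (legal-zeros d)

  splice : ∀ {d} → Mask d → CT d → CT d → CT d
  splice (leaf β)     (leaf x)     (leaf y)       = leaf (if β then x else y)
  splice (node M β N) (node l x r) (node l′ y r′) = node (splice M l l′) (if β then x else y) (splice N r r′)

  root-splice : ∀ {d} (M : Mask d) t t′ → root (splice M t t′) ≡ (if top M then root t else root t′)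
  root-splice (leaf β)     (leaf x)     (leaf y)       = refl
  root-splice (node M β N) (node l x r) (node l′ y r′) = refl

  splice-same : ∀ {d} (M : Mask d) t → splice M t t ≡ t
  splice-same (leaf β)     (leaf x)                                                 = cong leaf (if-eta β)
  splice-same (node M β N) (node l x r) rewrite splice-same M l | splice-same N r | if-eta β {x} = refl

  inorder-splice : ∀ {d} (M : Mask d) (t t′ : CT d) →
                   inorder (splice M t t′) ≡ select (inorderTree M) (inorder t) (inorder t′)
  inorder-splice (leaf β)     (leaf x)     (leaf y)       = ≡.refl
  inorder-splice (node M β N) (node l x r) (node l′ y r′) =
    ≡.trans (≡.cong₂ (λ u v → u ++ ((if β then x else y) ∷ v)) (inorder-splice M l l′) (inorder-splice N r r′))
            (≡.sym (select-++ (inorderTree M) (inorder l) (inorder l′)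
                      (≡.trans (length-inorderTree M) (≡.sym (length-inorder l)))
                      (≡.trans (length-inorder l) (≡.sym (length-inorder l′)))))

  record Fooling {d} (M : Mask d) (k : ℕ) : Set where
    field
      γ       : Vec (Fin m) k → CT d
      legal-γ : ∀ a → T (legal (γ a))
      fools   : ∀ a b → T (legal (splice M (γ a) (γ b))) → a ≡ b

    legal-splice-diag : ∀ a → T (legal (splice M (γ a) (γ a)))
    legal-splice-diag a = subst (T ∘ legal) (sym (splice-same M (γ a))) (legal-γ a)

  fooling₀ : ∀ {d} (M : Mask d) → Fooling M 0
  fooling₀ {d} M = record { γ = λ _ → zeros d ; legal-γ = λ _ → legal-zeros d ; fools = λ { [] [] _ → refl } }

  fooling-node : ∀ {d k₁ k₂} (M : Mask d) β N → Fooling M k₁ → Fooling N k₂ → Fooling (node M β N) (k₁ ℕ.+ k₂)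
  fooling-node {d} {k₁} {k₂} M β N 𝓕₁ 𝓕₂ = record
    { γ       = γ
    ; legal-γ = λ v → legal-join (F₁.γ (Vec.take k₁ v)) (F₂.γ (Vec.drop k₁ v))
                                 (F₁.legal-γ (Vec.take k₁ v)) (F₂.legal-γ (Vec.drop k₁ v))
    ; fools   = fools
    }
    where
    module F₁ = Fooling 𝓕₁
    module F₂ = Fooling 𝓕₂
    γ : Vec (Fin m) (k₁ ℕ.+ k₂) → CT (suc d)
    γ v = join (F₁.γ (Vec.take k₁ v)) (F₂.γ (Vec.drop k₁ v))
    fools : ∀ a b → T (legal (splice (node M β N) (γ a) (γ b))) → a ≡ b
    fools a b legal-ab with legal-node (splice (node M β N) (γ a) (γ b)) legal-ab
    ... | legal-l , _ , legal-r = begin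
      a                                  ≡⟨ Vecₚ.take++drop≡id k₁ a ⟨
      Vec.take k₁ a Vec.++ Vec.drop k₁ a
        ≡⟨ cong₂ Vec._++_ (F₁.fools (Vec.take k₁ a) (Vec.take k₁ b) legal-l) (F₂.fools (Vec.drop k₁ a) (Vec.drop k₁ b) legal-r) ⟩
      Vec.take k₁ b Vec.++ Vec.drop k₁ b ≡⟨ Vecₚ.take++drop≡id k₁ b ⟩
      b                                  ∎

  fooling-inˡ : ∀ {d k} (M : Mask d) β N → Fooling M k → Fooling (node M β N) k
  fooling-inˡ {k = k} M β N 𝓕 = subst (Fooling (node M β N)) (ℕₚ.+-identityʳ k) (fooling-node M β N 𝓕 (fooling₀ N))

  fooling-inʳ : ∀ {d k} (M : Mask d) β N → Fooling N k → Fooling (node M β N) k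
  fooling-inʳ M β N 𝓕 = fooling-node M β N (fooling₀ M) 𝓕

  root-spine-injective : ∀ d {c c′} → root (spine d c) ≡ root (spine d c′) → c ≡ c′
  root-spine-injective d {c} {c′} e = trans (sym (root-spine d c)) (trans e (root-spine d c′))

  -- Splicing takes the parent from one colouring and the child across the
  -- cut edge from the other, so the sum rule at the parent pins down the
  -- child's colour.
  cutʳ : ∀ {d} (ML MR : Mask d) z (l r r′ : CT d) → z ≢ top MR →
         T (legal (splice (node ML z MR) (join l r) (join l r′))) → root r ≡ root r′
  cutʳ ML MR z l r r′ z≢ legal-spliced with legal-node (splice (node ML z MR) (join l r) (join l r′)) legal-spliced
  ... | _ , root≡ , _ = if-≢ z≢ (+ₘ-cancelˡ (root l) (begin
    root l +ₘ (if z then root r else root r′)              ≡⟨ if-float (root l +ₘ_) z ⟩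
    (if z then root l +ₘ root r else root l +ₘ root r′)    ≡⟨ root≡ ⟩
    root (splice ML l l) +ₘ root (splice MR r r′)          ≡⟨ cong₂ _+ₘ_ (cong root (splice-same ML l)) (root-splice MR r r′) ⟩
    root l +ₘ (if top MR then root r else root r′)         ∎))

  cutˡ : ∀ {d} (ML MR : Mask d) z (l l′ r : CT d) → z ≢ top ML →
         T (legal (splice (node ML z MR) (join l r) (join l′ r))) → root l ≡ root l′
  cutˡ ML MR z l l′ r z≢ legal-spliced with legal-node (splice (node ML z MR) (join l r) (join l′ r)) legal-spliced
  ... | _ , root≡ , _ = if-≢ z≢ (+ₘ-cancelʳ (root r) (begin
    (if z then root l else root l′) +ₘ root r              ≡⟨ if-float (_+ₘ root r) z ⟩
    (if z then root l +ₘ root r else root l′ +ₘ root r)    ≡⟨ root≡ ⟩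
    root (splice ML l l′) +ₘ root (splice MR r r)          ≡⟨ cong₂ _+ₘ_ (root-splice ML l l′) (cong root (splice-same MR r)) ⟩
    (if top ML then root l else root l′) +ₘ root r         ∎))

  fooling-extend : ∀ {d k} (M : Mask d) (γ : Fin m → Vec (Fin m) k → CT d) →
           (∀ c a → T (legal (γ c a))) →
           (∀ c c′ a b → T (legal (splice M (γ c a) (γ c′ b))) → a ≡ b) →
           (∀ c c′ a → T (legal (splice M (γ c a) (γ c′ a))) → c ≡ c′) →
           Fooling M (suc k)
  fooling-extend M γ legal-γ fools-tail fools-head = record
    { γ = λ u → γ (Vec.head u) (Vec.tail u) ; legal-γ = λ u → legal-γ (Vec.head u) (Vec.tail u) ; fools = fools }
    where
    fools : ∀ u v → T (legal (splice M (γ (Vec.head u) (Vec.tail u)) (γ (Vec.head v) (Vec.tail v)))) → u ≡ v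
    fools (c ∷ a) (c′ ∷ b) legal-spliced with fools-tail c c′ a b legal-spliced
    ... | refl = cong (_∷ a) (fools-head c c′ a legal-spliced)

  fooling-cutʳ : ∀ {d k} (ML : Mask d) z MR → Fooling ML k → z ≢ top MR → Fooling (node ML z MR) (suc k)
  fooling-cutʳ {d} {k} ML z MR 𝓕 z≢ = fooling-extend _ γ′ (λ c a → legal-join (γ a) (spine d c) (legal-γ a) (legal-spine d c)) tail head
    where
    open Fooling 𝓕
    γ′ : Fin m → Vec (Fin m) k → CT (suc d)
    γ′ c a = join (γ a) (spine d c)
    tail : ∀ c c′ a b → T (legal (splice (node ML z MR) (γ′ c a) (γ′ c′ b))) → a ≡ b
    tail c c′ a b l = fools a b (proj₁ (legal-node (splice (node ML z MR) (γ′ c a) (γ′ c′ b)) l))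
    head : ∀ c c′ a → T (legal (splice (node ML z MR) (γ′ c a) (γ′ c′ a))) → c ≡ c′
    head c c′ a l = root-spine-injective d (cutʳ ML MR z (γ a) (spine d c) (spine d c′) z≢ l)

  fooling-cutˡ : ∀ {d k} (ML : Mask d) z MR → Fooling MR k → z ≢ top ML → Fooling (node ML z MR) (suc k)
  fooling-cutˡ {d} {k} ML z MR 𝓕 z≢ = fooling-extend _ γ′ (λ c a → legal-join (spine d c) (γ a) (legal-spine d c) (legal-γ a)) tail head
    where
    open Fooling 𝓕
    γ′ : Fin m → Vec (Fin m) k → CT (suc d)
    γ′ c a = join (spine d c) (γ a)
    tail : ∀ c c′ a b → T (legal (splice (node ML z MR) (γ′ c a) (γ′ c′ b))) → a ≡ b
    tail c c′ a b l = fools a b (proj₂ (proj₂ (legal-node (splice (node ML z MR) (γ′ c a) (γ′ c′ b)) l)))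
    head : ∀ c c′ a → T (legal (splice (node ML z MR) (γ′ c a) (γ′ c′ a))) → c ≡ c′
    head c c′ a l = root-spine-injective d (cutˡ ML MR z (spine d c) (spine d c′) (γ a) z≢ l)

  fooling-cutˡ-fromˡˡ : ∀ {d k} (MA : Mask d) z₁ MB z MR → Fooling MA k → z ≢ z₁ →
                        Fooling (node (node MA z₁ MB) z MR) (suc k)
  fooling-cutˡ-fromˡˡ {d} {k} MA z₁ MB z MR 𝓕 z≢ = fooling-extend _ γ′ legal-γ′ tail head
    where
    open Fooling 𝓕
    inner : Fin m → Vec (Fin m) k → CT (suc d)
    inner c a = join (γ a) (spine d c)
    γ′ : Fin m → Vec (Fin m) k → CT (suc (suc d))
    γ′ c a = join (inner c a) (zeros (suc d))
    legal-γ′ : ∀ c a → T (legal (γ′ c a))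
    legal-γ′ c a = legal-join (inner c a) (zeros (suc d)) (legal-join (γ a) (spine d c) (legal-γ a) (legal-spine d c)) (legal-zeros (suc d))
    tail : ∀ c c′ a b → T (legal (splice (node (node MA z₁ MB) z MR) (γ′ c a) (γ′ c′ b))) → a ≡ b
    tail c c′ a b l = fools a b (proj₁ (legal-node (splice (node MA z₁ MB) (inner c a) (inner c′ b))
                        (proj₁ (legal-node (splice (node (node MA z₁ MB) z MR) (γ′ c a) (γ′ c′ b)) l))))
    head : ∀ c c′ a → T (legal (splice (node (node MA z₁ MB) z MR) (γ′ c a) (γ′ c′ a))) → c ≡ c′
    head c c′ a l = root-spine-injective d (+ₘ-cancelˡ (root (γ a))
                      (cutˡ (node MA z₁ MB) MR z (inner c a) (inner c′ a) (zeros (suc d)) z≢ l))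

  fooling-cutˡ-fromˡʳ : ∀ {d k} (MA : Mask d) z₁ MB z MR → Fooling MB k → z ≢ z₁ →
                        Fooling (node (node MA z₁ MB) z MR) (suc k)
  fooling-cutˡ-fromˡʳ {d} {k} MA z₁ MB z MR 𝓕 z≢ = fooling-extend _ γ′ legal-γ′ tail head
    where
    open Fooling 𝓕
    inner : Fin m → Vec (Fin m) k → CT (suc d)
    inner c a = join (spine d c) (γ a)
    γ′ : Fin m → Vec (Fin m) k → CT (suc (suc d))
    γ′ c a = join (inner c a) (zeros (suc d))
    legal-γ′ : ∀ c a → T (legal (γ′ c a))
    legal-γ′ c a = legal-join (inner c a) (zeros (suc d)) (legal-join (spine d c) (γ a) (legal-spine d c) (legal-γ a)) (legal-zeros (suc d))
    tail : ∀ c c′ a b → T (legal (splice (node (node MA z₁ MB) z MR) (γ′ c a) (γ′ c′ b))) → a ≡ b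
    tail c c′ a b l = fools a b (proj₂ (proj₂ (legal-node (splice (node MA z₁ MB) (inner c a) (inner c′ b))
                        (proj₁ (legal-node (splice (node (node MA z₁ MB) z MR) (γ′ c a) (γ′ c′ b)) l)))))
    head : ∀ c c′ a → T (legal (splice (node (node MA z₁ MB) z MR) (γ′ c a) (γ′ c′ a))) → c ≡ c′
    head c c′ a l = root-spine-injective d (+ₘ-cancelʳ (root (γ a))
                      (cutˡ (node MA z₁ MB) MR z (inner c a) (inner c′ a) (zeros (suc d)) z≢ l))

  fooling-cutʳ-fromʳˡ : ∀ {d k} (ML : Mask (suc d)) z MC z₂ MD → Fooling MC k → z ≢ z₂ →
                        Fooling (node ML z (node MC z₂ MD)) (suc k)
  fooling-cutʳ-fromʳˡ {d} {k} ML z MC z₂ MD 𝓕 z≢ = fooling-extend _ γ′ legal-γ′ tail head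
    where
    open Fooling 𝓕
    inner : Fin m → Vec (Fin m) k → CT (suc d)
    inner c a = join (γ a) (spine d c)
    γ′ : Fin m → Vec (Fin m) k → CT (suc (suc d))
    γ′ c a = join (zeros (suc d)) (inner c a)
    legal-γ′ : ∀ c a → T (legal (γ′ c a))
    legal-γ′ c a = legal-join (zeros (suc d)) (inner c a) (legal-zeros (suc d)) (legal-join (γ a) (spine d c) (legal-γ a) (legal-spine d c))
    tail : ∀ c c′ a b → T (legal (splice (node ML z (node MC z₂ MD)) (γ′ c a) (γ′ c′ b))) → a ≡ b
    tail c c′ a b l = fools a b (proj₁ (legal-node (splice (node MC z₂ MD) (inner c a) (inner c′ b))
                        (proj₂ (proj₂ (legal-node (splice (node ML z (node MC z₂ MD)) (γ′ c a) (γ′ c′ b)) l)))))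
    head : ∀ c c′ a → T (legal (splice (node ML z (node MC z₂ MD)) (γ′ c a) (γ′ c′ a))) → c ≡ c′
    head c c′ a l = root-spine-injective d (+ₘ-cancelˡ (root (γ a))
                      (cutʳ ML (node MC z₂ MD) z (zeros (suc d)) (inner c a) (inner c′ a) z≢ l))

  fooling-mixed : ∀ {d} (M : Mask d) → Mixed M → Fooling M 1
  fooling-mixed (leaf β) (refl , ())
  fooling-mixed (node ML z MR) mixed with z ≟ᴮ top MR | z ≟ᴮ top ML
  ... | no z≢  | _      = fooling-cutʳ ML z MR (fooling₀ ML) z≢
  ... | yes _  | no z≢  = fooling-cutˡ ML z MR (fooling₀ MR) z≢
  ... | yes r≡ | yes l≡ with constant-or-mixed ML | constant-or-mixed MR
  ...   | inj₂ mixedL | _           = fooling-inˡ ML z MR (fooling-mixed ML mixedL)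
  ...   | inj₁ _      | inj₂ mixedR = fooling-inʳ ML z MR (fooling-mixed MR mixedR)
  ...   | inj₁ constL | inj₁ constR =
    ⊥-elim (constant⇒¬mixed z (node ML z MR)
             (subst (λ τ → Constant τ ML) (sym l≡) constL , refl , subst (λ τ → Constant τ MR) (sym r≡) constR) mixed)

  fooling-mixedʳ : ∀ {d k} (ML : Mask d) z MR → Fooling ML k → Mixed MR → Fooling (node ML z MR) (suc k)
  fooling-mixedʳ {k = k} ML z MR 𝓕 mixedR =
    subst (Fooling (node ML z MR)) (ℕₚ.+-comm k 1) (fooling-node ML z MR 𝓕 (fooling-mixed MR mixedR))

  -- Going up from the family's subtree, either an edge is cut, or a sibling
  -- subtree is mixed and adds a family of its own, or else all these masks
  -- are constant with one common value, which the hypothesis rules out.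
  fooling-growˡˡ : ∀ {d k} (MA : Mask d) z₁ MB z MR → Fooling MA k →
                   (∀ τ → Constant τ MB → Constant τ MR → ⊥) → Fooling (node (node MA z₁ MB) z MR) (suc k)
  fooling-growˡˡ MA z₁ MB z MR 𝓕 not-both-constant with z₁ ≟ᴮ top MB
  ... | no z₁≢ = fooling-inˡ (node MA z₁ MB) z MR (fooling-cutʳ MA z₁ MB 𝓕 z₁≢)
  ... | yes z₁≡ with constant-or-mixed MB
  ...   | inj₂ mixedB = fooling-inˡ (node MA z₁ MB) z MR (fooling-mixedʳ MA z₁ MB 𝓕 mixedB)
  ...   | inj₁ constB with z ≟ᴮ z₁
  ...     | no z≢ = fooling-cutˡ-fromˡˡ MA z₁ MB z MR 𝓕 z≢
  ...     | yes z≡ with z ≟ᴮ top MR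
  ...       | no z≢ = fooling-cutʳ (node MA z₁ MB) z MR (fooling-inˡ MA z₁ MB 𝓕) z≢
  ...       | yes z≡′ with constant-or-mixed MR
  ...         | inj₂ mixedR = fooling-mixedʳ (node MA z₁ MB) z MR (fooling-inˡ MA z₁ MB 𝓕) mixedR
  ...         | inj₁ constR =
    ⊥-elim (not-both-constant (top MB) constB (subst (λ τ → Constant τ MR) (trans (sym z≡′) (trans z≡ z₁≡)) constR))

  fooling-growˡʳ : ∀ {d k} (MA : Mask d) z₁ MB z MR → Fooling MB k →
                   (∀ τ → Constant τ MA → Constant τ MR → ⊥) → Fooling (node (node MA z₁ MB) z MR) (suc k)
  fooling-growˡʳ MA z₁ MB z MR 𝓕 not-both-constant with z₁ ≟ᴮ top MA
  ... | no z₁≢ = fooling-inˡ (node MA z₁ MB) z MR (fooling-cutˡ MA z₁ MB 𝓕 z₁≢)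
  ... | yes z₁≡ with constant-or-mixed MA
  ...   | inj₂ mixedA = fooling-inˡ (node MA z₁ MB) z MR (fooling-node MA z₁ MB (fooling-mixed MA mixedA) 𝓕)
  ...   | inj₁ constA with z ≟ᴮ z₁
  ...     | no z≢ = fooling-cutˡ-fromˡʳ MA z₁ MB z MR 𝓕 z≢
  ...     | yes z≡ with z ≟ᴮ top MR
  ...       | no z≢ = fooling-cutʳ (node MA z₁ MB) z MR (fooling-inʳ MA z₁ MB 𝓕) z≢
  ...       | yes z≡′ with constant-or-mixed MR
  ...         | inj₂ mixedR = fooling-mixedʳ (node MA z₁ MB) z MR (fooling-inʳ MA z₁ MB 𝓕) mixedR
  ...         | inj₁ constR =
    ⊥-elim (not-both-constant (top MA) constA (subst (λ τ → Constant τ MR) (trans (sym z≡′) (trans z≡ z₁≡)) constR))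

  fooling-growʳˡ : ∀ {d k} (ML : Mask (suc d)) z MC z₂ MD → Fooling MC k →
                   (∀ τ → ¬ Constant τ ML) → Fooling (node ML z (node MC z₂ MD)) (suc k)
  fooling-growʳˡ ML z MC z₂ MD 𝓕 non-constant with z₂ ≟ᴮ top MD
  ... | no z₂≢ = fooling-inʳ ML z (node MC z₂ MD) (fooling-cutʳ MC z₂ MD 𝓕 z₂≢)
  ... | yes _ with constant-or-mixed MD
  ...   | inj₂ mixedD = fooling-inʳ ML z (node MC z₂ MD) (fooling-mixedʳ MC z₂ MD 𝓕 mixedD)
  ...   | inj₁ _ with z ≟ᴮ z₂
  ...     | no z≢ = fooling-cutʳ-fromʳˡ ML z MC z₂ MD 𝓕 z≢
  ...     | yes _ with z ≟ᴮ top ML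
  ...       | no z≢ = fooling-cutˡ ML z (node MC z₂ MD) (fooling-inˡ MC z₂ MD 𝓕) z≢
  ...       | yes _ with constant-or-mixed ML
  ...         | inj₂ mixedL = fooling-node ML z (node MC z₂ MD) (fooling-mixed ML mixedL) (fooling-inˡ MC z₂ MD 𝓕)
  ...         | inj₁ constL = ⊥-elim (non-constant (top ML) constL)

  FoolingCut : ∀ {d} → Tree ℕ d → ℕ → Set
  FoolingCut X k = Σ ℕ λ i → Fooling (marks i X) k × Straddles i X

  -- Recursing into three pairwise disjoint subtrees two levels down and
  -- cutting at the median of their cuts separates the other two, which is
  -- what the growth lemmas need.
  fooling-cut : ∀ {d} (X : Tree ℕ (suc d)) → DistinctFromLeftChild X → FoolingCut X ⌊ suc d /2⌋
  fooling-cut {zero} X distinct with straddled X distinct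
  ... | i , straddles = i , fooling₀ (marks i X) , straddles
  fooling-cut {suc zero} X distinct with straddled X distinct
  ... | i , straddles = i , fooling-mixed (marks i X) (mixed-of-straddles i X straddles) , straddles
  fooling-cut {suc (suc d)} (node (node A t₁ B) t (node C t₂ D)) (_ , (_ , dA , dB) , (_ , dC , _))
    with fooling-cut A dA | fooling-cut B dB | fooling-cut C dC
  ... | iA , 𝓕A , sA@(beforeA , fromA) | iB , 𝓕B , sB@(beforeB , fromB) | iC , 𝓕C , sC@(beforeC , fromC)
    with median iA iB iC
  ... | inj₁ A-mid = iA ,
      fooling-growˡˡ (marks iA A) _ (marks iA B) _ (marks iA (node C t₂ D)) 𝓕A
        (λ τ constB constR → separated⇒¬constant iA B C (separated-at-median B C A-mid sB sC) τ constB (proj₁ constR)) ,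
      inj₁ (inj₁ beforeA) , inj₁ (inj₁ fromA)
  ... | inj₂ (inj₁ B-mid) = iB ,
      fooling-growˡʳ (marks iB A) _ (marks iB B) _ (marks iB (node C t₂ D)) 𝓕B
        (λ τ constA constR → separated⇒¬constant iB A C (separated-at-median A C B-mid sA sC) τ constA (proj₁ constR)) ,
      inj₁ (inj₂ (inj₂ beforeB)) , inj₁ (inj₂ (inj₂ fromB))
  ... | inj₂ (inj₂ C-mid) = iC ,
      fooling-growʳˡ (marks iC (node A t₁ B)) _ (marks iC C) _ (marks iC D) 𝓕C
        (λ τ (constA , _ , constB) → separated⇒¬constant iC A B (separated-at-median A B C-mid sA sB) τ constA constB) ,
      inj₂ (inj₂ (inj₁ beforeC)) , inj₂ (inj₂ (inj₁ fromC))

-- The lower bound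

module LowerBound {c ℓ : Level} (F : Field c ℓ) (d′ m′ : ℕ) (σ : Permutation′ (nodes (suc d′)))
                  (A : ABP F (suc m′))
                  (A-computes : _≈ₚ_ F (computed A) (Δ F (nodes (suc d′)) σ (Pd F (suc m′) (suc d′)))) where
  open Field F using (_≈_; 0#; 1#; 1≉0; reflexive; trans; sym)
  open Matrices F using (Matrix; _·_≈𝟙; δ; 𝟙-factorisation⇒≤)
  open Colourings m′
  open Layers F A
  open CoefficientsOfPd F using (Pd-inorder)
  open import Data.Vec using (Vec)

  d D K : ℕ
  d = suc d′
  D = nodes d
  K = ⌊ d /2⌋

  -- time k is the position in the word of the letter coming from the k-th
  -- node of T_d in in-order.
  time nodeAt : ℕ → ℕ
  time   = onℕ (σ ⟨$⟩ˡ_)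
  nodeAt = onℕ (σ ⟨$⟩ʳ_)

  nodeAt-time : ∀ k → nodeAt (time k) ≡ k
  nodeAt-time = onℕ-inverse (σ ⟨$⟩ˡ_) (σ ⟨$⟩ʳ_) (λ _ → inverseʳ σ)

  times : Tree ℕ d
  times = build d 0 time

  cut : FoolingCut times K
  cut = fooling-cut times (distinct-build d 0 time time-injective)
    where
    time-injective : ∀ {x y} → time x ≡ time y → x ≡ y
    time-injective {x} {y} e = ≡.trans (≡.sym (nodeAt-time x)) (≡.trans (≡.cong nodeAt e) (nodeAt-time y))

  i : ℕ
  i = proj₁ cut

  M : Mask d
  M = marks i times

  open Fooling (proj₁ (proj₂ cut))

  i<D : i < D
  i<D with all∧any⇒∃ times (all-build (_< D) d 0 time (λ k k< → onℕ-< (σ ⟨$⟩ˡ_) (≡.subst (k <_) (treeSize≡nodes d) k<)))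
                           (proj₂ (proj₂ (proj₂ cut)))
  ... | _ , t<D , i≤t = ℕₚ.≤-<-trans i≤t t<D

  colour : Vec (Fin m) K → ℕ → Fin m
  colour a = lookupOr Fin.zero (inorder (γ a))

  prefix suffix : Vec (Fin m) K → List (Fin m)
  prefix a = List.applyUpTo (colour a ∘ nodeAt) i
  suffix b = List.applyUpTo (λ q → colour b (nodeAt (i ℕ.+ q))) (D ∸ i)

  length-prefix : ∀ a → length (prefix a) ≡ i
  length-prefix a = Listₚ.length-applyUpTo _ i

  length-word : ∀ a b → length (prefix a ++ suffix b) ≡ D
  length-word a b = ≡.trans (Listₚ.length-++ (prefix a))
    (≡.trans (≡.cong₂ ℕ._+_ (length-prefix a) (Listₚ.length-applyUpTo _ (D ∸ i))) (ℕₚ.m+[n∸m]≡n (ℕₚ.<⇒≤ i<D)))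

  inorder-γ : ∀ a → inorder (γ a) ≡ List.applyUpTo (colour a) D
  inorder-γ a = ≡.trans (≡.sym (applyUpTo-lookupOr Fin.zero (inorder (γ a))))
                        (≡.cong (List.applyUpTo (colour a)) (≡.trans (length-inorder (γ a)) (treeSize≡nodes d)))

  inorder-M : inorderTree M ≡ List.applyUpTo (λ k → time k ℕ.<ᵇ i) D
  inorder-M = ≡.trans (inorderTree-mapTree (ℕ._<ᵇ i) times)
    (≡.trans (≡.cong (List.map (ℕ._<ᵇ i)) (inorderTree-build d 0 time))
    (≡.trans (Listₚ.map-applyUpTo time (ℕ._<ᵇ i) (treeSize d))
             (≡.cong (List.applyUpTo (λ k → time k ℕ.<ᵇ i)) (treeSize≡nodes d))))

  Δ-word : ∀ a b → Δ F D σ (Pd F m d) (prefix a ++ suffix b) ≡ Pd F m d (inorder (splice M (γ a) (γ b)))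
  Δ-word a b = begin
    Δ F D σ (Pd F m d) (prefix a ++ suffix b)
      ≡⟨ ≡.cong (Δ F D σ (Pd F m d)) (≡.sym (applyUpTo-<ᵇ (colour a ∘ nodeAt) (colour b ∘ nodeAt) (ℕₚ.<⇒≤ i<D))) ⟩
    Δ F D σ (Pd F m d) (List.applyUpTo (λ q → if q ℕ.<ᵇ i then colour a (nodeAt q) else colour b (nodeAt q)) D)
      ≡⟨ Δ-applyUpTo F D σ (Pd F m d) _ ⟩
    Pd F m d (List.applyUpTo (λ k → if time k ℕ.<ᵇ i then colour a (nodeAt (time k)) else colour b (nodeAt (time k))) D)
      ≡⟨ ≡.cong (Pd F m d) (applyUpTo-cong D (λ k → ≡.cong₂ (λ x y → if time k ℕ.<ᵇ i then x else y)
                                                  (≡.cong (colour a) (nodeAt-time k)) (≡.cong (colour b) (nodeAt-time k)))) ⟩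
    Pd F m d (List.applyUpTo (λ k → if time k ℕ.<ᵇ i then colour a k else colour b k) D)
      ≡⟨ ≡.cong (Pd F m d) (select-applyUpTo D (λ k → time k ℕ.<ᵇ i) (colour a) (colour b)) ⟨
    Pd F m d (select (List.applyUpTo (λ k → time k ℕ.<ᵇ i) D) (List.applyUpTo (colour a) D) (List.applyUpTo (colour b) D))
      ≡⟨ ≡.cong (Pd F m d) (≡.cong₂ (λ βs xs → select βs xs (List.applyUpTo (colour b) D)) inorder-M (inorder-γ a)) ⟨
    Pd F m d (select (inorderTree M) (inorder (γ a)) (List.applyUpTo (colour b) D))
      ≡⟨ ≡.cong (λ ys → Pd F m d (select (inorderTree M) (inorder (γ a)) ys)) (inorder-γ b) ⟨
    Pd F m d (select (inorderTree M) (inorder (γ a)) (inorder (γ b)))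
      ≡⟨ ≡.cong (Pd F m d) (inorder-splice M (γ a) (γ b)) ⟨
    Pd F m d (inorder (splice M (γ a) (γ b))) ∎
    where open ≡.≡-Reasoning

  coefficient : ∀ a b → computed A (prefix a ++ suffix b) ≈ (if legal (splice M (γ a) (γ b)) then 1# else 0#)
  coefficient a b = trans (A-computes (prefix a ++ suffix b)) (trans (reflexive (Δ-word a b)) (Pd-inorder m d (splice M (γ a) (γ b))))

  coefficient-diag : ∀ a → computed A (prefix a ++ suffix a) ≈ 1#
  coefficient-diag a = trans (coefficient a a) (reflexive (if-T (legal-splice-diag a)))

  len≡D : len A ≡ D
  len≡D with len A ℕ.≟ D
  ... | yes e   = e
  ... | no  len≢D = ⊥-elim (1≉0 (trans (sym (coefficient-diag a₀))
          (reflexive (computed-offLength (prefix a₀ ++ suffix a₀) (λ e → len≢D (≡.trans (≡.sym e) (length-word a₀ a₀)))))))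
    where
    a₀ = Data.Vec.replicate K Fin.zero

  row : Matrix (m ^ K) (size A i)
  row α x = fwdℕ (reverse (prefix (toVec K α))) (toℕ x)

  column : Matrix (size A i) (m ^ K)
  column x β = pathsℕ i (reverse (suffix (toVec K β))) (toℕ x) (toℕ (sink A))

  legal-splice-δ : ∀ α β → (if legal (splice M (γ (toVec K α)) (γ (toVec K β))) then 1# else 0#) ≡ δ α β
  legal-splice-δ α β with α Fin.≟ β
  ... | yes ≡.refl = if-T (legal-splice-diag (toVec K α))
  ... | no α≢β with legal (splice M (γ (toVec K α)) (γ (toVec K β))) in legal≡
  ...   | true  = ⊥-elim (α≢β (toVec-injective K (fools _ _ (≡.subst T (≡.sym legal≡) _))))
  ...   | false = ≡.refl

  row·column≈𝟙 : row · column ≈𝟙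
  row·column≈𝟙 α β = trans (sym (computed-through-layer (prefix a) (suffix b) i (length-prefix a) (≡.trans (length-word a b) (≡.sym len≡D))))
                     (trans (coefficient a b) (reflexive (legal-splice-δ α β)))
    where
    a = toVec K α
    b = toVec K β

  m^K≤width : m ^ K ≤ size A i
  m^K≤width = 𝟙-factorisation⇒≤ (m ^ K) (size A i) row column row·column≈𝟙

  i≤len : i ≤ len A
  i≤len = ≡.subst (i ≤_) (≡.sym len≡D) (ℕₚ.<⇒≤ i<D)

≤⌊/2⌋*4 : ∀ n → suc (suc n) ≤ ⌊ suc (suc n) /2⌋ ℕ.* 4
≤⌊/2⌋*4 zero          = s≤s (s≤s z≤n)
≤⌊/2⌋*4 (suc zero)    = s≤s (s≤s (s≤s z≤n))
≤⌊/2⌋*4 (suc (suc n)) = s≤s (s≤s (ℕₚ.m≤n⇒m≤o+n 2 (≤⌊/2⌋*4 n)))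

width-bound : ∀ {c ℓ : Level} (F : Field c ℓ) (d : ℕ) → 2 ≤ d →
  (m : ℕ) .{{_ : NonZero m}} (σ : Permutation′ (nodes d)) (A : ABP F m) →
  _≈ₚ_ F (computed A) (Δ F (nodes d) σ (Pd F m d)) →
  Σ ℕ λ N → WidthAtLeast F A N × m ^ d ≤ N ^ 4
width-bound F (suc zero)    (s≤s ()) _ _ _ _
width-bound F (suc (suc n)) _ (suc m′) σ A A-computes =
  size A i , (i , i≤len , ℕₚ.≤-refl) , (begin
    suc m′ ^ suc (suc n)           ≤⟨ ℕₚ.^-monoʳ-≤ (suc m′) (≤⌊/2⌋*4 n) ⟩
    suc m′ ^ (K ℕ.* 4)             ≡⟨ ℕₚ.^-*-assoc (suc m′) K 4 ⟨
    (suc m′ ^ K) ^ 4               ≤⟨ ℕₚ.^-monoˡ-≤ 4 m^K≤width ⟩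
    size A i ^ 4                   ∎)
  where
  open LowerBound F (suc n) m′ σ A A-computes
  open ℕₚ.≤-Reasoning

theorem4p2 : ∀ {c ℓ : Level} →
    Σ ℕ λ k → Σ ℕ λ d₀ →
    (F : Field c ℓ) (d : ℕ) → d₀ ≤ d →
    (m : ℕ) .{{_ : NonZero m}} (σ : Permutation′ (nodes d)) (A : ABP F m) →
    _≈ₚ_ F (computed A) (Δ F (nodes d) σ (Pd F m d)) →
    Σ ℕ λ N → WidthAtLeast F A N × m ^ d ≤ N ^ suc k
theorem4p2 = 3 , 2 , width-bound
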